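{- Let $F$ be a relevant collection with $\alpha(F)=\alpha$. Then $F$ is a maximal hke collection if and only if $F$ is isomorphic to the typical collection for $\alpha$.
   Context: A \emph{relevant collection} is a non-empty finite collection of finite sets all of which have the same positive cardinality, denoted $\alpha(F)$. A collection $F$ is an \emph{hke collection} if there is a positive integer $\alpha$ such that $|\bigcup \Gamma|+|\bigcap \Gamma|=2\alpha$ for every non-empty subcollection $\Gamma\subseteq F$. An hke collection $F$ is \emph{maximal} if there is no hke collection $F'$ with $F\subsetneq F'$. For a positive integer $\alpha$, the \emph{typical collection for $\alpha$} is the collection of all subsets $S\subseteq[2\alpha]=\{1,\dots,2\alpha\}$ such that for every $i\in[\alpha]$, $i\in S$ if and only if $i+\alpha\notin S$. Two collections $F_1,F_2$ are \emph{isomorphic} if there is a bijection $g:\bigcup F_1\to\bigcup F_2$ with $g[S]\in F_2$ for every $S\in F_1$ and $g^{ -1}[S]\in F_1$ for every $S\in F_2$. -}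

module Defs where

open import Data.Nat using (ℕ; _+_; _*_; _≤_; _<_)
open import Data.Nat.Properties using (_≟_)
open import Data.List using (List; []; _∷_; length; deduplicate; filter; concat; map)
open import Data.List.Relation.Unary.All using (All; all?)
open import Data.List.Membership.Propositional using (_∈_)
open import Data.List.Membership.DecPropositional _≟_ using (_∈?_)
open import Data.Product using (Σ; ∃; _×_)
open import Relation.Binary.PropositionalEquality using (_≡_; _≢_)
open import Relation.Nullary using (¬_)
open import Function.Bundles using (_⇔_)

-- A finite set of natural numbers is represented by a list (duplicates and
-- order are irrelevant: only membership matters). The ambient universe is ℕ.
FinSet : Set
FinSet = List ℕ

Collection : Set
Collection = List FinSet

SetEq : FinSet → FinSet → Set
SetEq S T = ∀ x → (x ∈ S) ⇔ (x ∈ T)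

card : FinSet → ℕ
card S = length (deduplicate _≟_ S)

⋃ : Collection → FinSet
⋃ Γ = concat Γ

⋂ : Collection → FinSet
⋂ [] = []
⋂ (S ∷ Γ) = filter (λ x → all? (λ T → x ∈? T) Γ) S

Relevant : ℕ → Collection → Set
Relevant α F = (F ≢ []) × (0 < α) × All (λ S → card S ≡ α) F

NonEmptySub : Collection → Collection → Set
NonEmptySub Γ F = (Γ ≢ []) × All (λ S → S ∈ F) Γ

HKE : Collection → Set
HKE F = Σ ℕ λ α → (0 < α) ×
  (∀ Γ → NonEmptySub Γ F → card (⋃ Γ) + card (⋂ Γ) ≡ 2 * α)

_∈c_ : FinSet → Collection → Set
S ∈c F = Σ FinSet λ T → (T ∈ F) × SetEq S T

_⊂c_ : Collection → Collection → Set
F ⊂c F' = All (λ S → S ∈c F') F × Σ FinSet λ S → (S ∈ F') × ¬ (S ∈c F)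

MaximalHKE : Collection → Set
MaximalHKE F = HKE F × (∀ F' → HKE F' → ¬ (F ⊂c F'))

-- Typical collection for α, given as a predicate on sets: S ⊆ [2α] and
-- for every i ∈ [α], i ∈ S iff i + α ∉ S.
Typical : ℕ → FinSet → Set
Typical α S = All (λ x → (1 ≤ x) × (x ≤ 2 * α)) S ×
  (∀ i → 1 ≤ i → i ≤ α → (i ∈ S) ⇔ (¬ (i + α ∈ S)))

⋃P : (FinSet → Set) → ℕ → Set
⋃P P y = Σ FinSet λ S → P S × (y ∈ S)

-- Isomorphism between a list-collection F and a predicate-collection P:
-- a bijection g : ⋃F → ⋃P (with inverse h) such that g[S] ∈ P for S ∈ F
-- and g⁻¹[S] = h[S] ∈ F for every S with P S.
Isomorphic : Collection → (FinSet → Set) → Set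
Isomorphic F P = Σ (ℕ → ℕ) λ g → Σ (ℕ → ℕ) λ h →
  (∀ x → x ∈ ⋃ F → ⋃P P (g x)) ×
  (∀ y → ⋃P P y → h y ∈ ⋃ F) ×
  (∀ x → x ∈ ⋃ F → h (g x) ≡ x) ×
  (∀ y → ⋃P P y → g (h y) ≡ y) ×
  (∀ S → S ∈ F → P (map g S)) ×
  (∀ S → P S → map h S ∈c F)

-- A pairing is a list of disjoint pairs of points, and a transversal of it contains exactly one
-- point of every pair and no other point; the typical collection for α is the collection of
-- transversals of {(i , i + α) | 1 ≤ i ≤ α}. For any nonempty family Γ of transversals, each pair
-- (a , b) satisfies [a ∈ ⋃ Γ] + [b ∈ ⋂ Γ] = 1 = [a ∈ ⋂ Γ] + [b ∈ ⋃ Γ], so |⋃ Γ| + |⋂ Γ| = 2 |Q|.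
--
-- Conversely, let F be hke and give every point x its type τ x, the set of members of F containing
-- x. The hke identity for the subcollection G says that ∑ₓ ([G meets τ x] + [G ⊆ τ x]) does not
-- depend on G. Comparing G = T with G = F for a heaviest non-full type T among all types and their
-- complements shows that T and ∁ T occur equally often; removing such a pair and repeating splits
-- the points into complementary pairs and points lying in every member, which are paired with new
-- points. So F consists of transversals of a pairing of size α. Maximality then means that F
-- contains every transversal: an hke collection containing all transversals consists of
-- transversals, as the identity for suitable triples shows. Two collections of all transversals of
-- pairings of the same size are isomorphic by relabelling the points.

module Submission where

open import Data.Nat using (ℕ; zero; suc; _+_; _*_; _≤_; _<_; z≤n; s≤s; _∸_; _≤?_; z<s)
open import Data.Nat.Properties
open import Algebra.Properties.CommutativeSemigroup +-commutativeSemigroup using (interchange)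
open import Data.Nat.ListAction using (sum)
open import Data.Nat.ListAction.Properties using (sum-↭)
open import Data.Bool using (Bool; true; false; not; _∧_; _∨_; if_then_else_)
open import Data.List using (List; []; _∷_; [_]; _++_; length; map; filter; concat; deduplicate)
open import Data.List.Properties using (++-identityʳ; ∷-injective; length-map; map-cong-local)
open import Data.List.Relation.Unary.All as All using (All; []; _∷_; all?)
open import Data.List.Relation.Unary.All.Properties using (¬Any⇒All¬; ¬All⇒Any¬) renaming (++⁻ˡ to All-++⁻ˡ)
open import Data.List.Relation.Unary.Any using (here; there; any?)
open import Data.List.Relation.Unary.AllPairs using ([]; _∷_)
open import Data.List.Relation.Unary.Unique.Propositional using (Unique)
open import Data.List.Relation.Unary.Unique.Propositional.Properties using (filter⁺; ++⁺)
open import Data.List.Relation.Unary.Unique.DecPropositional.Properties _≟_ using (deduplicate-!)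
open import Data.List.Relation.Binary.Permutation.Propositional
  using (_↭_; ↭-refl; ↭-sym; ↭-trans; ↭-prep; ↭-reflexive; ↭⇒↭ₛ)
open import Data.List.Relation.Binary.Permutation.Propositional.Properties
  using (∈-resp-↭; ↭-length; shift)
  renaming (map⁺ to ↭-map⁺)
open import Relation.Binary.PropositionalEquality
  using (_≡_; _≢_; refl; sym; trans; cong; cong₂; subst; setoid; module ≡-Reasoning)
open import Data.List.Relation.Binary.Permutation.Setoid.Properties (setoid ℕ) using (Unique-resp-↭)
open import Data.List.Relation.Binary.Subset.Propositional using (_⊆_)
open import Data.List.Relation.Binary.Subset.DecPropositional _≟_ using (_⊆?_)
open import Data.List.Relation.Binary.Disjoint.Propositional using (Disjoint)
open import Data.List.Membership.Propositional using (_∈_; _∉_; find; lose)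
open import Data.List.Membership.Propositional.Properties
open import Data.List.Membership.DecPropositional _≟_ using (_∈?_)
open import Data.Product using (Σ; ∃; ∃₂; _×_; _,_; proj₁; proj₂)
open import Data.Sum using (_⊎_; inj₁; inj₂)
open import Data.Empty using (⊥; ⊥-elim)
open import Function using (_∘_; id)
open import Function.Bundles using (_⇔_; mk⇔; Equivalence)
open import Function.Properties.Equivalence using () renaming (trans to ⇔-trans; sym to ⇔-sym)
open import Relation.Nullary using (¬_; Dec; yes; no; does; contradiction)
open import Relation.Nullary.Decidable using (dec-true; dec-false; map′; _×-dec_)
open import Relation.Unary using (Pred; Decidable)
open import Level using (0ℓ)
open import Data.Vec as Vec using (Vec; []; _∷_)
open import Data.Vec.Properties using () renaming (≡-dec to ≡-decᵛ)
open import Data.Bool.Properties using (not-involutive; ¬-not) renaming (_≟_ to _≟ᵇ_)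
open import Data.List.Extrema ≤-totalOrder using (argmax; argmax-all; f[xs]≤f[argmax])
open import Data.Product.Properties using (≡-dec)
open import Relation.Binary.Definitions using (DecidableEquality)
open import Defs

open Equivalence using (to; from)

𝟙 : Bool → ℕ
𝟙 true = 1
𝟙 false = 0

𝟙-exclusive : ∀ {P R : Set} (P? : Dec P) (R? : Dec R) → (P → ¬ R) → (¬ R → P) →
  𝟙 (does P?) + 𝟙 (does R?) ≡ 1
𝟙-exclusive (yes p) (yes r) P⇒¬R _ = contradiction r (P⇒¬R p)
𝟙-exclusive (yes _) (no _) _ _ = refl
𝟙-exclusive (no _) (yes _) _ _ = refl
𝟙-exclusive (no ¬p) (no ¬r) _ ¬R⇒P = contradiction (¬R⇒P ¬r) ¬p

𝟙-atMostOne : ∀ {P R : Set} (P? : Dec P) (R? : Dec R) → (P → ¬ R) → 𝟙 (does P?) + 𝟙 (does R?) ≤ 1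
𝟙-atMostOne (yes p) (yes r) P⇒¬R = contradiction r (P⇒¬R p)
𝟙-atMostOne (yes _) (no _) _ = ≤-refl
𝟙-atMostOne (no _) (yes _) _ = ≤-refl
𝟙-atMostOne (no _) (no _) _ = z≤n

𝟙-exactlyOne : ∀ {P R : Set} (P? : Dec P) (R? : Dec R) → 𝟙 (does P?) + 𝟙 (does R?) ≡ 1 → P ⇔ (¬ R)
𝟙-exactlyOne (yes p) (no ¬r) _ = mk⇔ (λ _ → ¬r) (λ _ → p)
𝟙-exactlyOne (no ¬p) (yes r) _ = mk⇔ (λ p → contradiction p ¬p) (λ ¬r → contradiction r ¬r)

𝟙-not : ∀ b → 𝟙 b + 𝟙 (not b) ≡ 1
𝟙-not true = refl
𝟙-not false = refl

does-true⇒ : ∀ {P : Set} (P? : Dec P) → does P? ≡ true → P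
does-true⇒ (yes p) _ = p

does-cong : ∀ {P R : Set} (P? : Dec P) (R? : Dec R) → (P → R) → (R → P) → does P? ≡ does R?
does-cong (yes _) (yes _) _ _ = refl
does-cong (no _) (no _) _ _ = refl
does-cong (yes p) (no ¬r) P⇒R _ = contradiction (P⇒R p) ¬r
does-cong (no ¬p) (yes r) _ R⇒P = contradiction (R⇒P r) ¬p

⇔¬-cong : ∀ {A A′ B B′ : Set} → A′ ⇔ A → B′ ⇔ B → A ⇔ (¬ B) → A′ ⇔ (¬ B′)
⇔¬-cong A′⇔A B′⇔B A⇔¬B =
  mk⇔ (λ a′ b′ → to A⇔¬B (to A′⇔A a′) (to B′⇔B b′))
      (λ ¬b′ → from A′⇔A (from A⇔¬B (¬b′ ∘ from B′⇔B)))

+≡suc-split : ∀ {a b n} → a ≤ 1 → b ≤ n → a + b ≡ suc n → a ≡ 1 × b ≡ n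
+≡suc-split {0} _ b≤n refl = contradiction b≤n 1+n≰n
+≡suc-split {1} _ _ a+b≡ = refl , suc-injective a+b≡
+≡suc-split {suc (suc _)} (s≤s ()) _ _

∑ : {A : Set} → List A → (A → ℕ) → ℕ
∑ xs f = sum (map f xs)

module _ {A : Set} where

  ∑-cong : ∀ (xs : List A) {f g : A → ℕ} → (∀ {x} → x ∈ xs → f x ≡ g x) → ∑ xs f ≡ ∑ xs g
  ∑-cong [] _ = refl
  ∑-cong (x ∷ xs) f≗g = cong₂ _+_ (f≗g (here refl)) (∑-cong xs (f≗g ∘ there))

  ∑-+ : ∀ (xs : List A) (f g : A → ℕ) → ∑ xs (λ x → f x + g x) ≡ ∑ xs f + ∑ xs g
  ∑-+ [] f g = refl
  ∑-+ (x ∷ xs) f g =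
    trans (cong (f x + g x +_) (∑-+ xs f g)) (interchange (f x) (g x) (∑ xs f) (∑ xs g))

  ∑-const : ∀ (xs : List A) k → ∑ xs (λ _ → k) ≡ k * length xs
  ∑-const [] k = sym (*-zeroʳ k)
  ∑-const (x ∷ xs) k = trans (cong (k +_) (∑-const xs k)) (sym (*-suc k (length xs)))

  ∑-count-length : ∀ (xs : List A) → ∑ xs (λ _ → 1) ≡ length xs
  ∑-count-length xs = trans (∑-const xs 1) (*-identityˡ (length xs))

  ∑-↭ : ∀ (f : A → ℕ) {xs ys} → xs ↭ ys → ∑ xs f ≡ ∑ ys f
  ∑-↭ f xs↭ys = sum-↭ (↭-map⁺ f xs↭ys)

  ∑≤length : ∀ (xs : List A) {f : A → ℕ} → (∀ {x} → x ∈ xs → f x ≤ 1) → ∑ xs f ≤ length xs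
  ∑≤length [] _ = z≤n
  ∑≤length (x ∷ xs) f≤1 = +-mono-≤ (f≤1 (here refl)) (∑≤length xs (f≤1 ∘ there))

  ∑≡length⇒≡1 : ∀ (xs : List A) {f : A → ℕ} → (∀ {x} → x ∈ xs → f x ≤ 1) →
    ∑ xs f ≡ length xs → ∀ {x} → x ∈ xs → f x ≡ 1
  ∑≡length⇒≡1 (y ∷ xs) f≤1 total (here refl) =
    proj₁ (+≡suc-split (f≤1 (here refl)) (∑≤length xs (f≤1 ∘ there)) total)
  ∑≡length⇒≡1 (y ∷ xs) f≤1 total (there x∈) =
    ∑≡length⇒≡1 xs (f≤1 ∘ there) (proj₂ (+≡suc-split (f≤1 (here refl)) (∑≤length xs (f≤1 ∘ there)) total)) x∈

  ∑𝟙-positive⇒∃ : ∀ (xs : List A) (p : A → Bool) → 1 ≤ ∑ xs (𝟙 ∘ p) → ∃ λ x → x ∈ xs × p x ≡ true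
  ∑𝟙-positive⇒∃ (x ∷ xs) p pos with p x in px
  ... | true = x , here refl , px
  ... | false = let y , y∈ , py = ∑𝟙-positive⇒∃ xs p pos in y , there y∈ , py

  ∃⇒∑𝟙-positive : ∀ (xs : List A) (p : A → Bool) {x} → x ∈ xs → p x ≡ true → 1 ≤ ∑ xs (𝟙 ∘ p)
  ∃⇒∑𝟙-positive (y ∷ xs) p (here refl) px rewrite px = s≤s z≤n
  ∃⇒∑𝟙-positive (y ∷ xs) p (there x∈) px =
    ≤-trans (∃⇒∑𝟙-positive xs p x∈ px) (m≤n+m _ (𝟙 (p y)))

  ∑𝟙-does≡length-filter : ∀ {P : Pred A 0ℓ} (P? : Decidable P) xs →
    ∑ xs (𝟙 ∘ does ∘ P?) ≡ length (filter P? xs)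
  ∑𝟙-does≡length-filter P? [] = refl
  ∑𝟙-does≡length-filter P? (x ∷ xs) with does (P? x)
  ... | true = cong suc (∑𝟙-does≡length-filter P? xs)
  ... | false = ∑𝟙-does≡length-filter P? xs

∈⇒≤sum : ∀ {x xs} → x ∈ xs → x ≤ sum xs
∈⇒≤sum {xs = y ∷ xs} (here refl) = m≤m+n y (sum xs)
∈⇒≤sum {xs = y ∷ xs} (there x∈) = ≤-trans (∈⇒≤sum x∈) (m≤n+m (sum xs) y)

unique-∷ : ∀ {A : Set} {x : A} {xs} → x ∉ xs → Unique xs → Unique (x ∷ xs)
unique-∷ x∉ u = ¬Any⇒All¬ _ x∉ ∷ u

Unique-++⁻ : ∀ {A : Set} (xs : List A) {ys} → Unique (xs ++ ys) → Unique xs × Unique ys × Disjoint xs ys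
Unique-++⁻ [] u = [] , u , λ ()
Unique-++⁻ (x ∷ xs) (x∉ ∷ u) =
  let uxs , uys , xs#ys = Unique-++⁻ xs u in
  (All-++⁻ˡ xs x∉ ∷ uxs) , uys ,
  λ { (here refl , v∈ys) → All.lookup x∉ (∈-++⁺ʳ xs v∈ys) refl
    ; (there v∈xs , v∈ys) → xs#ys (v∈xs , v∈ys) }

Unique-length≤ : ∀ {A : Set} {xs : List A} ys → Unique xs → xs ⊆ ys → length xs ≤ length ys
Unique-length≤ ys [] _ = z≤n
Unique-length≤ {xs = a ∷ xs} ys (a∉ ∷ u) a∷xs⊆ys with ∈-∃++ (a∷xs⊆ys (here refl))
... | ys₁ , ys₂ , refl =
  subst (suc (length xs) ≤_) (sym (↭-length (shift a ys₁ ys₂)))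
    (s≤s (Unique-length≤ (ys₁ ++ ys₂) u xs⊆ys₁++ys₂))
  where
  xs⊆ys₁++ys₂ : xs ⊆ ys₁ ++ ys₂
  xs⊆ys₁++ys₂ x∈ with ∈-resp-↭ (shift a ys₁ ys₂) (a∷xs⊆ys (there x∈))
  ... | here refl = contradiction refl (All.lookup a∉ x∈)
  ... | there x∈′ = x∈′

Unique-resp-↭′ : ∀ {xs ys : List ℕ} → xs ↭ ys → Unique xs → Unique ys
Unique-resp-↭′ xs↭ys = Unique-resp-↭ (↭⇒↭ₛ xs↭ys)

Unique-map-injectiveOn : ∀ {A B : Set} {f : A → B} {xs} → (∀ {x y} → x ∈ xs → y ∈ xs → f x ≡ f y → x ≡ y) →
  Unique xs → Unique (map f xs)
Unique-map-injectiveOn {xs = []} _ [] = []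
Unique-map-injectiveOn {f = f} {x ∷ xs} injective (x∉ ∷ u) =
  unique-∷ fx∉ (Unique-map-injectiveOn (λ x∈ y∈ → injective (there x∈) (there y∈)) u)
  where
  fx∉ : f x ∉ map f xs
  fx∉ fx∈ = let y , y∈ , fx≡fy = ∈-map⁻ f fx∈ in All.lookup x∉ y∈ (injective (here refl) (there y∈) fx≡fy)

↭-extract₂ : ∀ {A : Set} {x y : A} {xs} → x ∈ xs → y ∈ xs → x ≢ y → ∃ λ ys → xs ↭ x ∷ y ∷ ys
↭-extract₂ {x = x} {y} x∈ y∈ x≢y with ∈-∃++ x∈
... | as , bs , refl with ∈-resp-↭ (shift x as bs) y∈
...   | here y≡x = contradiction (sym y≡x) x≢y
...   | there y∈′ with ∈-∃++ y∈′
...     | cs , ds , as++bs≡ =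
  cs ++ ds , ↭-trans (shift x as bs) (↭-prep x (↭-trans (↭-reflexive as++bs≡) (shift y cs ds)))

_∈ᵇ_ : ℕ → FinSet → Bool
x ∈ᵇ X = does (x ∈? X)

card-cong : ∀ {X Y} → X ⊆ Y → Y ⊆ X → card X ≡ card Y
card-cong {X} {Y} X⊆Y Y⊆X = ≤-antisym (bound X⊆Y) (bound Y⊆X)
  where
  bound : ∀ {X Y} → X ⊆ Y → card X ≤ card Y
  bound {X} {Y} X⊆Y = Unique-length≤ (deduplicate _≟_ Y) (deduplicate-! X)
    (∈-deduplicate⁺ _≟_ ∘ X⊆Y ∘ ∈-deduplicate⁻ _≟_ X)

Unique⇒length≤card : ∀ {L} X → Unique L → L ⊆ X → length L ≤ card X
Unique⇒length≤card X u L⊆X = Unique-length≤ (deduplicate _≟_ X) u (∈-deduplicate⁺ _≟_ ∘ L⊆X)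

card≡∑ : ∀ X {W} → Unique W → X ⊆ W → card X ≡ ∑ W (λ x → 𝟙 (x ∈ᵇ X))
card≡∑ X {W} u X⊆W = trans (≤-antisym card≤ card≥) (sym (∑𝟙-does≡length-filter (_∈? X) W))
  where
  card≤ : card X ≤ length (filter (_∈? X) W)
  card≤ = Unique-length≤ (filter (_∈? X) W) (deduplicate-! X)
    (λ x∈ → let x∈X = ∈-deduplicate⁻ _≟_ X x∈ in ∈-filter⁺ (_∈? X) (X⊆W x∈X) x∈X)
  card≥ : length (filter (_∈? X) W) ≤ card X
  card≥ = Unique⇒length≤card X (filter⁺ (_∈? X) u) (proj₂ ∘ ∈-filter⁻ (_∈? X) {xs = W})

SetEq-trans : ∀ {A B C} → SetEq A B → SetEq B C → SetEq A C
SetEq-trans A≈B B≈C x = mk⇔ (to (B≈C x) ∘ to (A≈B x)) (from (A≈B x) ∘ from (B≈C x))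

SetEq? : ∀ C T → Dec (SetEq C T)
SetEq? C T = map′ (λ (C⊆T , T⊆C) x → mk⇔ (λ x∈ → C⊆T x∈) (λ x∈ → T⊆C x∈))
                  (λ C≈T → (λ {x} → to (C≈T x)) , (λ {x} → from (C≈T x)))
                  (C ⊆? T ×-dec T ⊆? C)

_∈c?_ : ∀ C F → Dec (C ∈c F)
C ∈c? F = map′ find (λ (T , T∈ , C≈T) → lose T∈ C≈T) (any? (SetEq? C) F)

map-inverse-SetEq : ∀ {g h : ℕ → ℕ} {S} → (∀ {x} → x ∈ S → h (g x) ≡ x) → SetEq S (map h (map g S))
map-inverse-SetEq {g} {h} {S} h∘g≗id x = mk⇔
  (λ x∈ → subst (_∈ map h (map g S)) (h∘g≗id x∈) (∈-map⁺ h (∈-map⁺ g x∈)))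
  (λ x∈ → let w , w∈ , x≡hw = ∈-map⁻ h x∈
              y , y∈ , w≡gy = ∈-map⁻ g w∈
          in subst (_∈ S) (sym (trans x≡hw (trans (cong h w≡gy) (h∘g≗id y∈)))) y∈)

∈-⋃⁻ : ∀ {x} Γ → x ∈ ⋃ Γ → ∃ λ S → S ∈ Γ × x ∈ S
∈-⋃⁻ Γ x∈ = let S , x∈S , S∈Γ = ∈-concat⁻′ Γ x∈ in S , S∈Γ , x∈S

∈-⋃⁺ : ∀ {x S Γ} → S ∈ Γ → x ∈ S → x ∈ ⋃ Γ
∈-⋃⁺ S∈Γ x∈S = ∈-concat⁺′ x∈S S∈Γ

∈-⋂⁻ : ∀ {x} Γ → x ∈ ⋂ Γ → ∀ {S} → S ∈ Γ → x ∈ S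
∈-⋂⁻ (S₀ ∷ Γ) x∈ (here refl) = proj₁ (∈-filter⁻ (λ x → all? (x ∈?_) Γ) {xs = S₀} x∈)
∈-⋂⁻ (S₀ ∷ Γ) x∈ (there S∈Γ) = All.lookup (proj₂ (∈-filter⁻ (λ x → all? (x ∈?_) Γ) {xs = S₀} x∈)) S∈Γ

∈-⋂⁺ : ∀ {x} Γ → Γ ≢ [] → (∀ {S} → S ∈ Γ → x ∈ S) → x ∈ ⋂ Γ
∈-⋂⁺ [] Γ≢[] _ = contradiction refl Γ≢[]
∈-⋂⁺ (S₀ ∷ Γ) _ x∈all = ∈-filter⁺ (λ x → all? (x ∈?_) Γ) (x∈all (here refl)) (All.tabulate (x∈all ∘ there))

⋂⊆⋃ : ∀ Γ → ⋂ Γ ⊆ ⋃ Γ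
⋂⊆⋃ (S ∷ Γ) x∈ = ∈-⋃⁺ {Γ = S ∷ Γ} (here refl) (∈-⋂⁻ (S ∷ Γ) x∈ (here refl))

HKE-card : ∀ {F} (hke : HKE F) → ∀ {S} → S ∈ F → card S ≡ proj₁ hke
HKE-card (α , _ , hke) {S} S∈F = *-cancelˡ-≡ (card S) α 2 (begin
  2 * card S                  ≡⟨ cong (card S +_) (+-identityʳ (card S)) ⟩
  card S + card S             ≡⟨ sym (cong₂ _+_ (card-cong ⋃[S]⊆S ⊆⋃[S]) (card-cong ⋂[S]⊆S ⊆⋂[S])) ⟩
  card (⋃ [ S ]) + card (⋂ [ S ]) ≡⟨ hke [ S ] ((λ ()) , S∈F ∷ []) ⟩
  2 * α                       ∎)
  where
  open ≡-Reasoning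
  ⋃[S]⊆S : ⋃ [ S ] ⊆ S
  ⋃[S]⊆S x∈ = subst (_ ∈_) (++-identityʳ S) x∈
  ⊆⋃[S] : S ⊆ ⋃ [ S ]
  ⊆⋃[S] = ∈-⋃⁺ {Γ = [ S ]} (here refl)
  ⋂[S]⊆S : ⋂ [ S ] ⊆ S
  ⋂[S]⊆S x∈ = ∈-⋂⁻ [ S ] x∈ (here refl)
  ⊆⋂[S] : S ⊆ ⋂ [ S ]
  ⊆⋂[S] x∈ = ∈-⋂⁺ [ S ] (λ ()) λ { (here refl) → x∈ }

-- Pairings and their transversals

Pairing : Set
Pairing = List (ℕ × ℕ)

_≟₂_ : DecidableEquality (ℕ × ℕ)
_≟₂_ = ≡-dec _≟_ _≟_

points : Pairing → List ℕ
points [] = []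
points ((a , b) ∷ Q) = a ∷ b ∷ points Q

DisjointPairs : Pairing → Set
DisjointPairs Q = Unique (points Q)

Transversal : Pairing → FinSet → Set
Transversal Q S = S ⊆ points Q × (∀ {p} → p ∈ Q → (proj₁ p ∈ S) ⇔ (proj₂ p ∉ S))

fst∈points : ∀ {Q p} → p ∈ Q → proj₁ p ∈ points Q
fst∈points {(a , b) ∷ Q} (here refl) = here refl
fst∈points {(a , b) ∷ Q} (there p∈) = there (there (fst∈points p∈))

snd∈points : ∀ {Q p} → p ∈ Q → proj₂ p ∈ points Q
snd∈points {(a , b) ∷ Q} (here refl) = there (here refl)
snd∈points {(a , b) ∷ Q} (there p∈) = there (there (snd∈points p∈))

∈points⁻ : ∀ {y} Q → y ∈ points Q → ∃ λ p → p ∈ Q × (y ≡ proj₁ p ⊎ y ≡ proj₂ p)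
∈points⁻ ((a , b) ∷ Q) (here y≡a) = (a , b) , here refl , inj₁ y≡a
∈points⁻ ((a , b) ∷ Q) (there (here y≡b)) = (a , b) , here refl , inj₂ y≡b
∈points⁻ ((a , b) ∷ Q) (there (there y∈)) = let p , p∈ , y≡ = ∈points⁻ Q y∈ in p , there p∈ , y≡

length-points : ∀ Q → length (points Q) ≡ 2 * length Q
length-points [] = refl
length-points (p ∷ Q) = trans (cong (2 +_) (length-points Q)) (sym (*-suc 2 (length Q)))

∑-points : ∀ Q (f : ℕ → ℕ) → ∑ (points Q) f ≡ ∑ Q (λ p → f (proj₁ p) + f (proj₂ p))
∑-points [] f = refl
∑-points ((a , b) ∷ Q) f = trans (cong (λ s → f a + (f b + s)) (∑-points Q f)) (sym (+-assoc (f a) (f b) _))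

points-++ : ∀ P R → points (P ++ R) ≡ points P ++ points R
points-++ [] R = refl
points-++ ((a , b) ∷ P) R = cong (λ l → a ∷ b ∷ l) (points-++ P R)

snd≢fst : ∀ {Q p q} → DisjointPairs Q → p ∈ Q → q ∈ Q → proj₂ p ≢ proj₁ q
snd≢fst {(a , b) ∷ Q} (a∉ ∷ _) (here refl) (here refl) = All.lookup a∉ (here refl) ∘ sym
snd≢fst {(a , b) ∷ Q} (_ ∷ b∉ ∷ _) (here refl) (there q∈) = All.lookup b∉ (fst∈points q∈)
snd≢fst {(a , b) ∷ Q} (a∉ ∷ _) (there p∈) (here refl) = All.lookup a∉ (there (snd∈points p∈)) ∘ sym
snd≢fst {(a , b) ∷ Q} (_ ∷ _ ∷ u) (there p∈) (there q∈) = snd≢fst u p∈ q∈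

fst-unique : ∀ {Q p q} → DisjointPairs Q → p ∈ Q → q ∈ Q → proj₁ p ≡ proj₁ q → p ≡ q
fst-unique {(a , b) ∷ Q} _ (here refl) (here refl) _ = refl
fst-unique {(a , b) ∷ Q} (a∉ ∷ _) (here refl) (there q∈) a≡ =
  contradiction a≡ (All.lookup a∉ (there (fst∈points q∈)))
fst-unique {(a , b) ∷ Q} (a∉ ∷ _) (there p∈) (here refl) ≡a =
  contradiction (sym ≡a) (All.lookup a∉ (there (fst∈points p∈)))
fst-unique {(a , b) ∷ Q} (_ ∷ _ ∷ u) (there p∈) (there q∈) eq = fst-unique u p∈ q∈ eq

snd-unique : ∀ {Q p q} → DisjointPairs Q → p ∈ Q → q ∈ Q → proj₂ p ≡ proj₂ q → p ≡ q
snd-unique {(a , b) ∷ Q} _ (here refl) (here refl) _ = refl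
snd-unique {(a , b) ∷ Q} (_ ∷ b∉ ∷ _) (here refl) (there q∈) b≡ =
  contradiction b≡ (All.lookup b∉ (snd∈points q∈))
snd-unique {(a , b) ∷ Q} (_ ∷ b∉ ∷ _) (there p∈) (here refl) ≡b =
  contradiction (sym ≡b) (All.lookup b∉ (snd∈points p∈))
snd-unique {(a , b) ∷ Q} (_ ∷ _ ∷ u) (there p∈) (there q∈) eq = snd-unique u p∈ q∈ eq

Transversal-resp-SetEq : ∀ {Q S S′} → SetEq S S′ → Transversal Q S′ → Transversal Q S
Transversal-resp-SetEq S≈S′ (⊆points , pairs) =
  (λ {x} x∈ → ⊆points (to (S≈S′ x) x∈)) ,
  λ {p} p∈ → ⇔¬-cong (S≈S′ (proj₁ p)) (S≈S′ (proj₂ p)) (pairs p∈)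

transversal-pair-count : ∀ {Q S p} → Transversal Q S → p ∈ Q → 𝟙 (proj₁ p ∈ᵇ S) + 𝟙 (proj₂ p ∈ᵇ S) ≡ 1
transversal-pair-count {S = S} {p} (_ , exactlyOne) p∈ =
  𝟙-exclusive (proj₁ p ∈? S) (proj₂ p ∈? S) (to (exactlyOne p∈)) (from (exactlyOne p∈))

card-transversal : ∀ {Q S} → DisjointPairs Q → Transversal Q S → card S ≡ length Q
card-transversal {Q} {S} disj trS = begin
  card S                                           ≡⟨ card≡∑ S disj (proj₁ trS) ⟩
  ∑ (points Q) (λ x → 𝟙 (x ∈ᵇ S))                  ≡⟨ ∑-points Q _ ⟩
  ∑ Q (λ p → 𝟙 (proj₁ p ∈ᵇ S) + 𝟙 (proj₂ p ∈ᵇ S)) ≡⟨ ∑-cong Q (transversal-pair-count trS) ⟩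
  ∑ Q (λ _ → 1)                                    ≡⟨ ∑-count-length Q ⟩
  length Q                                         ∎
  where open ≡-Reasoning

-- If every S ∈ Γ contains exactly one of a, b then a ∈ ⋃ Γ iff b ∉ ⋂ Γ, and a ∈ ⋂ Γ iff b ∉ ⋃ Γ.
complementary-pair-contribution : ∀ {a b} Γ → Γ ≢ [] → (∀ {S} → S ∈ Γ → (a ∈ S) ⇔ (b ∉ S)) →
  (𝟙 (a ∈ᵇ ⋃ Γ) + 𝟙 (a ∈ᵇ ⋂ Γ)) + (𝟙 (b ∈ᵇ ⋃ Γ) + 𝟙 (b ∈ᵇ ⋂ Γ)) ≡ 2
complementary-pair-contribution {a} {b} Γ Γ≢[] a⇔b∉ = begin
  (a⋃ + a⋂) + (b⋃ + b⋂) ≡⟨ cong ((a⋃ + a⋂) +_) (+-comm b⋃ b⋂) ⟩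
  (a⋃ + a⋂) + (b⋂ + b⋃) ≡⟨ interchange a⋃ a⋂ b⋂ b⋃ ⟩
  (a⋃ + b⋂) + (a⋂ + b⋃) ≡⟨ cong₂ _+_ (𝟙-exclusive (a ∈? ⋃ Γ) (b ∈? ⋂ Γ) a∈⋃⇒b∉⋂ b∉⋂⇒a∈⋃)
                                      (𝟙-exclusive (a ∈? ⋂ Γ) (b ∈? ⋃ Γ) a∈⋂⇒b∉⋃ b∉⋃⇒a∈⋂) ⟩
  2                     ∎
  where
  open ≡-Reasoning
  a⋃ = 𝟙 (a ∈ᵇ ⋃ Γ)
  a⋂ = 𝟙 (a ∈ᵇ ⋂ Γ)
  b⋃ = 𝟙 (b ∈ᵇ ⋃ Γ)
  b⋂ = 𝟙 (b ∈ᵇ ⋂ Γ)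
  a∈⋃⇒b∉⋂ : a ∈ ⋃ Γ → b ∉ ⋂ Γ
  a∈⋃⇒b∉⋂ a∈ b∈ = let S , S∈ , a∈S = ∈-⋃⁻ Γ a∈ in to (a⇔b∉ S∈) a∈S (∈-⋂⁻ Γ b∈ S∈)
  b∉⋂⇒a∈⋃ : b ∉ ⋂ Γ → a ∈ ⋃ Γ
  b∉⋂⇒a∈⋃ b∉ with all? (b ∈?_) Γ
  ... | yes b∈all = contradiction (∈-⋂⁺ Γ Γ≢[] (All.lookup b∈all)) b∉
  ... | no ¬b∈all = let S , S∈ , b∉S = find (¬All⇒Any¬ (b ∈?_) Γ ¬b∈all) in ∈-⋃⁺ S∈ (from (a⇔b∉ S∈) b∉S)
  a∈⋂⇒b∉⋃ : a ∈ ⋂ Γ → b ∉ ⋃ Γ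
  a∈⋂⇒b∉⋃ a∈ b∈ = let S , S∈ , b∈S = ∈-⋃⁻ Γ b∈ in to (a⇔b∉ S∈) (∈-⋂⁻ Γ a∈ S∈) b∈S
  b∉⋃⇒a∈⋂ : b ∉ ⋃ Γ → a ∈ ⋂ Γ
  b∉⋃⇒a∈⋂ b∉ = ∈-⋂⁺ Γ Γ≢[] (λ S∈ → from (a⇔b∉ S∈) (b∉ ∘ ∈-⋃⁺ S∈))

transversals-hke : ∀ {Q} → DisjointPairs Q → ∀ Γ → Γ ≢ [] → (∀ {S} → S ∈ Γ → Transversal Q S) →
  card (⋃ Γ) + card (⋂ Γ) ≡ 2 * length Q
transversals-hke disj [] Γ≢[] _ = contradiction refl Γ≢[]
transversals-hke {Q} disj Γ@(S₀ ∷ _) Γ≢[] tr = begin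
  card (⋃ Γ) + card (⋂ Γ)
    ≡⟨ cong₂ _+_ (card≡∑ (⋃ Γ) disj ⋃Γ⊆points) (card≡∑ (⋂ Γ) disj ⋂Γ⊆points) ⟩
  ∑ (points Q) (λ x → 𝟙 (x ∈ᵇ ⋃ Γ)) + ∑ (points Q) (λ x → 𝟙 (x ∈ᵇ ⋂ Γ))
    ≡⟨ sym (∑-+ (points Q) _ _) ⟩
  ∑ (points Q) (λ x → 𝟙 (x ∈ᵇ ⋃ Γ) + 𝟙 (x ∈ᵇ ⋂ Γ))
    ≡⟨ ∑-points Q _ ⟩
  ∑ Q (λ p → (𝟙 (proj₁ p ∈ᵇ ⋃ Γ) + 𝟙 (proj₁ p ∈ᵇ ⋂ Γ))
            + (𝟙 (proj₂ p ∈ᵇ ⋃ Γ) + 𝟙 (proj₂ p ∈ᵇ ⋂ Γ)))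
    ≡⟨ ∑-cong Q (λ p∈ → complementary-pair-contribution Γ Γ≢[] (λ S∈ → proj₂ (tr S∈) p∈)) ⟩
  ∑ Q (λ _ → 2)
    ≡⟨ ∑-const Q 2 ⟩
  2 * length Q
    ∎
  where
  open ≡-Reasoning
  ⋃Γ⊆points : ⋃ Γ ⊆ points Q
  ⋃Γ⊆points x∈ = let S , S∈ , x∈S = ∈-⋃⁻ Γ x∈ in proj₁ (tr S∈) x∈S
  ⋂Γ⊆points : ⋂ Γ ⊆ points Q
  ⋂Γ⊆points x∈ = proj₁ (tr (here refl)) (∈-⋂⁻ Γ x∈ (here refl))

transversals⇒HKE : ∀ {Q F} → DisjointPairs Q → 0 < length Q → (∀ {S} → S ∈ F → Transversal Q S) → HKE F
transversals⇒HKE {Q} disj pos trF =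
  length Q , pos , λ Γ (Γ≢[] , Γ⊆F) → transversals-hke disj Γ Γ≢[] (trF ∘ All.lookup Γ⊆F)

chosen : (ℕ × ℕ → Bool) → ℕ × ℕ → ℕ
chosen c p = if c p then proj₁ p else proj₂ p

choose : (ℕ × ℕ → Bool) → Pairing → FinSet
choose c Q = map (chosen c) Q

chosen-true : ∀ c {p} → c p ≡ true → chosen c p ≡ proj₁ p
chosen-true c cp rewrite cp = refl

chosen-false : ∀ c {p} → c p ≡ false → chosen c p ≡ proj₂ p
chosen-false c cp rewrite cp = refl

firsts seconds : Pairing → FinSet
firsts = choose (λ _ → true)
seconds = choose (λ _ → false)

points⊆firsts∪seconds : ∀ {y} Q → y ∈ points Q → y ∈ firsts Q ⊎ y ∈ seconds Q
points⊆firsts∪seconds Q y∈ with ∈points⁻ Q y∈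
... | p , p∈ , inj₁ refl = inj₁ (∈-map⁺ proj₁ p∈)
... | p , p∈ , inj₂ refl = inj₂ (∈-map⁺ proj₂ p∈)

module _ (c : ℕ × ℕ → Bool) {Q : Pairing} (disj : DisjointPairs Q) where

  chosen∈choose : ∀ {p} → p ∈ Q → chosen c p ∈ choose c Q
  chosen∈choose = ∈-map⁺ (chosen c)

  fst∉choose : ∀ {p} → p ∈ Q → c p ≡ false → proj₁ p ∉ choose c Q
  fst∉choose {p} p∈ cp x∈ with ∈-map⁻ (chosen c) x∈
  ... | q , q∈ , eq with c q in cq
  ...   | true = contradiction (trans (sym cq) (trans (cong c (sym (fst-unique disj p∈ q∈ eq))) cp)) λ ()
  ...   | false = snd≢fst disj q∈ p∈ (sym eq)

  snd∉choose : ∀ {p} → p ∈ Q → c p ≡ true → proj₂ p ∉ choose c Q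
  snd∉choose {p} p∈ cp x∈ with ∈-map⁻ (chosen c) x∈
  ... | q , q∈ , eq with c q in cq
  ...   | true = snd≢fst disj p∈ q∈ eq
  ...   | false = contradiction (trans (sym cp) (trans (cong c (snd-unique disj p∈ q∈ eq)) cq)) λ ()

  choose-transversal : Transversal Q (choose c Q)
  choose-transversal = choose⊆points , exactlyOne
    where
    choose⊆points : choose c Q ⊆ points Q
    choose⊆points x∈ with ∈-map⁻ (chosen c) x∈
    ... | p , p∈ , refl with c p
    ...   | true = fst∈points p∈
    ...   | false = snd∈points p∈
    exactlyOne : ∀ {p} → p ∈ Q → (proj₁ p ∈ choose c Q) ⇔ (proj₂ p ∉ choose c Q)
    exactlyOne {p} p∈ with c p in cp | chosen∈choose p∈
    ... | true | fst∈ = mk⇔ (λ _ → snd∉choose p∈ cp) (λ _ → fst∈)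
    ... | false | snd∈ = mk⇔ (λ fst∈ → contradiction fst∈ (fst∉choose p∈ cp)) (λ snd∉ → contradiction snd∈ snd∉)

transversal-cover : ∀ {Q} → DisjointPairs Q → ∀ {y} → y ∈ points Q → ∃ λ C → Transversal Q C × y ∈ C
transversal-cover {Q} disj y∈ with points⊆firsts∪seconds Q y∈
... | inj₁ y∈ᶠ = firsts Q , choose-transversal (λ _ → true) disj , y∈ᶠ
... | inj₂ y∈ˢ = seconds Q , choose-transversal (λ _ → false) disj , y∈ˢ

-- Collections of all transversals are maximal

AllTransversals : Pairing → Collection → Set
AllTransversals Q F = (∀ {S} → S ∈ F → Transversal Q S) × (∀ {C} → Transversal Q C → C ∈c F)

module HKEContainingAllTransversals {Q : Pairing} (disj : DisjointPairs Q) {F : Collection} (hkeF : HKE F)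
                                    (contains : ∀ {C} → Transversal Q C → C ∈c F) where

  private
    α = proj₁ hkeF
    F-hke = proj₂ (proj₂ hkeF)

    representative : ∀ {C} → Transversal Q C → Σ FinSet λ T → T ∈ F × C ⊆ T
    representative trC = let T , T∈ , C≈T = contains trC in T , T∈ , λ {x} → to (C≈T x)

    Tᶠ = representative (choose-transversal (λ _ → true) disj)
    Tˢ = representative (choose-transversal (λ _ → false) disj)

  α≡length : α ≡ length Q
  α≡length = begin
    α                ≡⟨ sym (HKE-card hkeF T∈) ⟩
    card T           ≡⟨ card-cong (λ {x} → from (C≈T x)) (λ {x} → to (C≈T x)) ⟩
    card (firsts Q)  ≡⟨ card-transversal disj (choose-transversal (λ _ → true) disj) ⟩
    length Q         ∎
    where
    open ≡-Reasoning
    T∈C≈T = contains (choose-transversal (λ _ → true) disj)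
    T = proj₁ T∈C≈T
    T∈ = proj₁ (proj₂ T∈C≈T)
    C≈T = proj₂ (proj₂ T∈C≈T)

  no-overfull-triple : ∀ {S T₁ T₂} → S ∈ F → T₁ ∈ F → T₂ ∈ F →
    let Γ = S ∷ T₁ ∷ T₂ ∷ [] in suc (2 * length Q) ≤ card (⋃ Γ) + card (⋂ Γ) → ⊥
  no-overfull-triple S∈ T₁∈ T₂∈ overfull =
    1+n≰n (subst (suc (2 * length Q) ≤_) hke overfull)
    where
    hke = trans (F-hke _ ((λ ()) , S∈ ∷ T₁∈ ∷ T₂∈ ∷ [])) (cong (2 *_) α≡length)

  -- A point of S outside the pairing makes |⋃ {S, firsts, seconds}| exceed 2 |Q|.
  ⊆points : ∀ {S} → S ∈ F → S ⊆ points Q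
  ⊆points {S} S∈ {x} x∈S with x ∈? points Q
  ... | yes x∈ = x∈
  ... | no x∉ = ⊥-elim (no-overfull-triple S∈ (proj₁ (proj₂ Tᶠ)) (proj₁ (proj₂ Tˢ))
                  (≤-trans (subst (_≤ card (⋃ Γ)) (cong suc (length-points Q))
                                  (Unique⇒length≤card (⋃ Γ) (unique-∷ x∉ disj) covered))
                           (m≤m+n _ _)))
    where
    Γ = S ∷ proj₁ Tᶠ ∷ proj₁ Tˢ ∷ []
    covered : x ∷ points Q ⊆ ⋃ Γ
    covered (here refl) = ∈-⋃⁺ {Γ = Γ} (here refl) x∈S
    covered (there y∈) with points⊆firsts∪seconds Q y∈
    ... | inj₁ y∈ᶠ = ∈-⋃⁺ {Γ = Γ} (there (here refl)) (proj₂ (proj₂ Tᶠ) y∈ᶠ)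
    ... | inj₂ y∈ˢ = ∈-⋃⁺ {Γ = Γ} (there (there (here refl))) (proj₂ (proj₂ Tˢ) y∈ˢ)

  -- If S contains both points of p, then together with firsts and Tᵖ (seconds except at p) it
  -- covers every point and all three share proj₁ p, so |⋃ Γ| + |⋂ Γ| > 2 |Q|.
  ¬both : ∀ {S p} → S ∈ F → p ∈ Q → proj₁ p ∈ S → proj₂ p ∈ S → ⊥
  ¬both {S} {p} S∈ p∈ fst∈S snd∈S = no-overfull-triple S∈ (proj₁ (proj₂ Tᵖ)) (proj₁ (proj₂ Tᶠ))
    (subst (_≤ card (⋃ Γ) + card (⋂ Γ)) (+-comm (2 * length Q) 1)
      (+-mono-≤ (subst (_≤ card (⋃ Γ)) (length-points Q) (Unique⇒length≤card (⋃ Γ) disj points⊆⋃))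
                (Unique⇒length≤card (⋂ Γ) ([] ∷ []) [fst]⊆⋂)))
    where
    only-p : ℕ × ℕ → Bool
    only-p q = does (q ≟₂ p)
    Tᵖ = representative (choose-transversal only-p disj)
    Γ = S ∷ proj₁ Tᵖ ∷ proj₁ Tᶠ ∷ []
    points⊆⋃ : points Q ⊆ ⋃ Γ
    points⊆⋃ y∈ with ∈points⁻ Q y∈
    ... | q , q∈ , inj₁ refl = ∈-⋃⁺ {Γ = Γ} (there (there (here refl))) (proj₂ (proj₂ Tᶠ) (∈-map⁺ proj₁ q∈))
    ... | q , q∈ , inj₂ refl with q ≟₂ p
    ...   | yes refl = ∈-⋃⁺ {Γ = Γ} (here refl) snd∈S
    ...   | no q≢p = ∈-⋃⁺ {Γ = Γ} (there (here refl)) (proj₂ (proj₂ Tᵖ)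
                       (subst (_∈ choose only-p Q) (chosen-false only-p {q} (dec-false (q ≟₂ p) q≢p))
                              (chosen∈choose only-p disj q∈)))
    [fst]⊆⋂ : [ proj₁ p ] ⊆ ⋂ Γ
    [fst]⊆⋂ (here refl) = ∈-⋂⁺ Γ (λ ()) λ
      { (here refl) → fst∈S
      ; (there (here refl)) → proj₂ (proj₂ Tᵖ)
          (subst (_∈ choose only-p Q) (chosen-true only-p {p} (dec-true (p ≟₂ p) refl)) (chosen∈choose only-p disj p∈))
      ; (there (there (here refl))) → proj₂ (proj₂ Tᶠ) (∈-map⁺ proj₁ p∈) }

  transversal : ∀ {S} → S ∈ F → Transversal Q S
  transversal {S} S∈ = ⊆points S∈ , λ {p} p∈ → 𝟙-exactlyOne (proj₁ p ∈? S) (proj₂ p ∈? S) (pair-count≡1 p∈)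
    where
    pair-count≤1 : ∀ {p} → p ∈ Q → 𝟙 (proj₁ p ∈ᵇ S) + 𝟙 (proj₂ p ∈ᵇ S) ≤ 1
    pair-count≤1 {p} p∈ = 𝟙-atMostOne (proj₁ p ∈? S) (proj₂ p ∈? S) (¬both S∈ p∈)
    total : ∑ Q (λ p → 𝟙 (proj₁ p ∈ᵇ S) + 𝟙 (proj₂ p ∈ᵇ S)) ≡ length Q
    total = begin
      ∑ Q (λ p → 𝟙 (proj₁ p ∈ᵇ S) + 𝟙 (proj₂ p ∈ᵇ S)) ≡⟨ sym (∑-points Q _) ⟩
      ∑ (points Q) (λ x → 𝟙 (x ∈ᵇ S))                  ≡⟨ sym (card≡∑ S disj (⊆points S∈)) ⟩
      card S                                           ≡⟨ HKE-card hkeF S∈ ⟩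
      α                                                ≡⟨ α≡length ⟩
      length Q                                         ∎
      where open ≡-Reasoning
    pair-count≡1 : ∀ {p} → p ∈ Q → 𝟙 (proj₁ p ∈ᵇ S) + 𝟙 (proj₂ p ∈ᵇ S) ≡ 1
    pair-count≡1 = ∑≡length⇒≡1 Q pair-count≤1 total

AllTransversals⇒MaximalHKE : ∀ {Q F} → DisjointPairs Q → 0 < length Q → AllTransversals Q F → MaximalHKE F
AllTransversals⇒MaximalHKE {Q} {F} disj pos (trF , containsF) = transversals⇒HKE disj pos trF , maximal
  where
  maximal : ∀ F′ → HKE F′ → ¬ (F ⊂c F′)
  maximal F′ hkeF′ (F⊆F′ , S , S∈F′ , S∉F) = S∉F (containsF (transversal S∈F′))
    where
    containsF′ : ∀ {C} → Transversal Q C → C ∈c F′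
    containsF′ trC =
      let T , T∈F , C≈T = containsF trC
          T′ , T′∈F′ , T≈T′ = All.lookup F⊆F′ T∈F
      in T′ , T′∈F′ , SetEq-trans C≈T T≈T′
    open HKEContainingAllTransversals disj hkeF′ containsF′ using (transversal)

MaximalHKE⇒contains-transversals : ∀ {Q F} → MaximalHKE F → DisjointPairs Q → 0 < length Q →
  (∀ {S} → S ∈ F → Transversal Q S) → ∀ {C} → Transversal Q C → C ∈c F
MaximalHKE⇒contains-transversals {Q} {F} (_ , maximal) disj pos trF {C} trC with C ∈c? F
... | yes C∈ = C∈
... | no C∉ = ⊥-elim (maximal (C ∷ F) (transversals⇒HKE disj pos trC∷F) (F⊆C∷F , C , here refl , C∉))
  where
  trC∷F : ∀ {S} → S ∈ C ∷ F → Transversal Q S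
  trC∷F (here refl) = trC
  trC∷F (there S∈) = trF S∈
  F⊆C∷F : All (_∈c (C ∷ F)) F
  F⊆C∷F = All.tabulate λ {S} S∈ → S , there S∈ , λ _ → mk⇔ id id

-- Types of points

-- A Boolean vector of length n is a set of indices of a collection of n sets.
_≟ᵛ_ : ∀ {n} → DecidableEquality (Vec Bool n)
_≟ᵛ_ = ≡-decᵛ _≟ᵇ_

full : ∀ {n} → Vec Bool n
full = Vec.replicate _ true

∁ : ∀ {n} → Vec Bool n → Vec Bool n
∁ = Vec.map not

weight : ∀ {n} → Vec Bool n → ℕ
weight [] = 0
weight (b ∷ t) = 𝟙 b + weight t

intersects : ∀ {n} → Vec Bool n → Vec Bool n → Bool
intersects [] [] = false
intersects (g ∷ G) (b ∷ t) = (g ∧ b) ∨ intersects G t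

_⊆ᵇ_ : ∀ {n} → Vec Bool n → Vec Bool n → Bool
[] ⊆ᵇ [] = true
(g ∷ G) ⊆ᵇ (b ∷ t) = (not g ∨ b) ∧ (G ⊆ᵇ t)

∁-involutive : ∀ {n} (t : Vec Bool n) → ∁ (∁ t) ≡ t
∁-involutive [] = refl
∁-involutive (b ∷ t) = cong₂ _∷_ (not-involutive b) (∁-involutive t)

intersects-∁ : ∀ {n} (G t : Vec Bool n) → intersects G (∁ t) ≡ not (G ⊆ᵇ t)
intersects-∁ [] [] = refl
intersects-∁ (true ∷ G) (true ∷ t) = intersects-∁ G t
intersects-∁ (true ∷ G) (false ∷ t) = refl
intersects-∁ (false ∷ G) (b ∷ t) = intersects-∁ G t

⊆ᵇ-∁ : ∀ {n} (G t : Vec Bool n) → G ⊆ᵇ ∁ t ≡ not (intersects G t)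
⊆ᵇ-∁ [] [] = refl
⊆ᵇ-∁ (true ∷ G) (true ∷ t) = refl
⊆ᵇ-∁ (true ∷ G) (false ∷ t) = ⊆ᵇ-∁ G t
⊆ᵇ-∁ (false ∷ G) (b ∷ t) = ⊆ᵇ-∁ G t

⊆ᵇ-refl : ∀ {n} (t : Vec Bool n) → t ⊆ᵇ t ≡ true
⊆ᵇ-refl [] = refl
⊆ᵇ-refl (true ∷ t) = ⊆ᵇ-refl t
⊆ᵇ-refl (false ∷ t) = ⊆ᵇ-refl t

full⊆ᵇ⇒⊆ᵇ : ∀ {n} (G t : Vec Bool n) → full ⊆ᵇ t ≡ true → G ⊆ᵇ t ≡ true
full⊆ᵇ⇒⊆ᵇ [] [] _ = refl
full⊆ᵇ⇒⊆ᵇ (true ∷ G) (true ∷ t) full⊆t = full⊆ᵇ⇒⊆ᵇ G t full⊆t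
full⊆ᵇ⇒⊆ᵇ (false ∷ G) (true ∷ t) full⊆t = full⊆ᵇ⇒⊆ᵇ G t full⊆t

intersects-comm : ∀ {n} (G t : Vec Bool n) → intersects G t ≡ intersects t G
intersects-comm [] [] = refl
intersects-comm (true ∷ G) (true ∷ t) = refl
intersects-comm (true ∷ G) (false ∷ t) = intersects-comm G t
intersects-comm (false ∷ G) (true ∷ t) = intersects-comm G t
intersects-comm (false ∷ G) (false ∷ t) = intersects-comm G t

⊆ᵇ⇒intersects : ∀ {n} (G t : Vec Bool n) → G ⊆ᵇ t ≡ true → intersects G full ≡ true → intersects G t ≡ true
⊆ᵇ⇒intersects [] [] _ ()
⊆ᵇ⇒intersects (true ∷ G) (true ∷ t) _ _ = refl
⊆ᵇ⇒intersects (false ∷ G) (b ∷ t) G⊆t G≠∅ = ⊆ᵇ⇒intersects G t G⊆t G≠∅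

intersects⇒nonempty : ∀ {n} (G t : Vec Bool n) → intersects G t ≡ true → intersects G full ≡ true
intersects⇒nonempty [] [] ()
intersects⇒nonempty (true ∷ G) (b ∷ t) _ = refl
intersects⇒nonempty (false ∷ G) (b ∷ t) G∩t = intersects⇒nonempty G t G∩t

nonempty⇒≢∁ : ∀ {n} (t : Vec Bool n) → intersects full t ≡ true → t ≢ ∁ t
nonempty⇒≢∁ [] ()
nonempty⇒≢∁ (true ∷ t) _ ()
nonempty⇒≢∁ (false ∷ t) t≠∅ ()

⊆ᵇ⇒weight≤ : ∀ {n} (G t : Vec Bool n) → G ⊆ᵇ t ≡ true → weight G ≤ weight t
⊆ᵇ⇒weight≤ [] [] _ = z≤n
⊆ᵇ⇒weight≤ (true ∷ G) (true ∷ t) G⊆t = s≤s (⊆ᵇ⇒weight≤ G t G⊆t)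
⊆ᵇ⇒weight≤ (false ∷ G) (b ∷ t) G⊆t = ≤-trans (⊆ᵇ⇒weight≤ G t G⊆t) (m≤n+m (weight t) (𝟙 b))

⊆ᵇ-weight-antisym : ∀ {n} (G t : Vec Bool n) → G ⊆ᵇ t ≡ true → weight t ≤ weight G → G ≡ t
⊆ᵇ-weight-antisym [] [] _ _ = refl
⊆ᵇ-weight-antisym (true ∷ G) (true ∷ t) G⊆t t≤G = cong (true ∷_) (⊆ᵇ-weight-antisym G t G⊆t (≤-pred t≤G))
⊆ᵇ-weight-antisym (false ∷ G) (false ∷ t) G⊆t t≤G = cong (false ∷_) (⊆ᵇ-weight-antisym G t G⊆t t≤G)
⊆ᵇ-weight-antisym (false ∷ G) (true ∷ t) G⊆t t≤G = contradiction t≤G (<⇒≱ (s≤s (⊆ᵇ⇒weight≤ G t G⊆t)))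

contribution-complementary : ∀ {n} (G t : Vec Bool n) →
  (𝟙 (intersects G t) + 𝟙 (G ⊆ᵇ t)) + (𝟙 (intersects G (∁ t)) + 𝟙 (G ⊆ᵇ ∁ t)) ≡ 2
contribution-complementary G t rewrite intersects-∁ G t | ⊆ᵇ-∁ G t with intersects G t | G ⊆ᵇ t
... | true | true = refl
... | true | false = refl
... | false | true = refl
... | false | false = refl

-- Elements are classified by their type τ x, the set of members of the collection containing x.
module Decomposition {n : ℕ} (τ : ℕ → Vec Bool n) where

  isFull : ℕ → Bool
  isFull x = full ⊆ᵇ τ x

  -- The contribution of x to |⋃ Γ| + |⋂ Γ|, for the subcollection Γ selected by G.
  contribution : Vec Bool n → ℕ → ℕ
  contribution G x = 𝟙 (intersects G (τ x)) + 𝟙 (G ⊆ᵇ τ x)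

  Occupied : List ℕ → Set
  Occupied V = ∀ {x} → x ∈ V → intersects full (τ x) ≡ true

  ConstantContribution : List ℕ → Set
  ConstantContribution V = Σ ℕ λ c → ∀ G → intersects G full ≡ true → ∑ V (contribution G) ≡ c

  Splitting : List ℕ → Set
  Splitting V = Σ Pairing λ P → Σ (List ℕ) λ K →
    K ++ points P ↭ V × (∀ {x} → x ∈ K → isFull x ≡ true) ×
    (∀ {p} → p ∈ P → τ (proj₂ p) ≡ ∁ (τ (proj₁ p)))

  candidates : List ℕ → List (Vec Bool n)
  candidates [] = []
  candidates (x ∷ V) = if isFull x then candidates V else τ x ∷ ∁ (τ x) ∷ candidates V

  candidate⁺ : ∀ {x V} → x ∈ V → isFull x ≡ false → τ x ∈ candidates V × ∁ (τ x) ∈ candidates V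
  candidate⁺ {V = y ∷ V} x∈ x-partial with isFull y in y-full
  candidate⁺ (here refl) x-partial | true = contradiction (trans (sym y-full) x-partial) λ ()
  candidate⁺ (there x∈) x-partial | true = candidate⁺ x∈ x-partial
  candidate⁺ (here refl) x-partial | false = here refl , there (here refl)
  candidate⁺ (there x∈) x-partial | false =
    let τx∈ , ∁τx∈ = candidate⁺ x∈ x-partial in there (there τx∈) , there (there ∁τx∈)

  candidate⁻ : ∀ {t} V → t ∈ candidates V → ∃ λ x → x ∈ V × isFull x ≡ false × (t ≡ τ x ⊎ t ≡ ∁ (τ x))
  candidate⁻ (x ∷ V) t∈ with isFull x in x-full
  candidate⁻ (x ∷ V) t∈ | true = let y , y∈ , rest = candidate⁻ V t∈ in y , there y∈ , rest
  candidate⁻ (x ∷ V) (here t≡) | false = x , here refl , x-full , inj₁ t≡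
  candidate⁻ (x ∷ V) (there (here t≡)) | false = x , here refl , x-full , inj₂ t≡
  candidate⁻ (x ∷ V) (there (there t∈)) | false = let y , y∈ , rest = candidate⁻ V t∈ in y , there y∈ , rest

  -- T is a heaviest type among the partial types and their complements. By maximality, a partial
  -- type containing T equals T, and a type disjoint from T equals ∁ T.
  module HeaviestCandidate {V} (occupied : Occupied V) {x₀} (x₀∈ : x₀ ∈ V) (x₀-partial : isFull x₀ ≡ false) where

    T : Vec Bool n
    T = argmax weight (τ x₀) (candidates V)

    T-heaviest : ∀ {u} → u ∈ candidates V → weight u ≤ weight T
    T-heaviest = All.lookup (f[xs]≤f[argmax] (τ x₀) (candidates V))

    T-candidate : ∃ λ x → x ∈ V × isFull x ≡ false × (T ≡ τ x ⊎ T ≡ ∁ (τ x))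
    T-candidate = candidate⁻ V (argmax-all weight (proj₁ (candidate⁺ x₀∈ x₀-partial)) (All.tabulate id))

    T-nonempty : intersects T full ≡ true
    T-nonempty with T-candidate
    ... | x , x∈ , _ , inj₁ T≡τx = trans (intersects-comm T full) (trans (cong (intersects full) T≡τx) (occupied x∈))
    ... | x , x∈ , x-partial , inj₂ T≡∁τx = trans (intersects-comm T full)
          (trans (cong (intersects full) T≡∁τx) (trans (intersects-∁ full (τ x)) (cong not x-partial)))

    T-partial : full ⊆ᵇ T ≡ false
    T-partial with T-candidate
    ... | x , x∈ , x-partial , inj₁ T≡τx = trans (cong (full ⊆ᵇ_) T≡τx) x-partial
    ... | x , x∈ , _ , inj₂ T≡∁τx =
      trans (cong (full ⊆ᵇ_) T≡∁τx) (trans (⊆ᵇ-∁ full (τ x)) (cong not (occupied x∈)))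

    included-count : ∀ {x} → x ∈ V → 𝟙 (T ⊆ᵇ τ x) ≡ 𝟙 (does (τ x ≟ᵛ T)) + 𝟙 (isFull x)
    included-count {x} x∈ with isFull x in x-full
    ... | true =
      trans (cong 𝟙 (full⊆ᵇ⇒⊆ᵇ T (τ x) x-full)) (cong (λ b → 𝟙 b + 1) (sym (dec-false (τ x ≟ᵛ T) τx≢T)))
      where
      τx≢T : τ x ≢ T
      τx≢T τx≡T = contradiction (trans (sym x-full) (trans (cong (full ⊆ᵇ_) τx≡T) T-partial)) λ ()
    ... | false with T ⊆ᵇ τ x in T⊆τx
    ...   | true = cong (λ b → 𝟙 b + 0) (sym (dec-true (τ x ≟ᵛ T) τx≡T))
      where
      τx≡T : τ x ≡ T
      τx≡T = sym (⊆ᵇ-weight-antisym T (τ x) T⊆τx (T-heaviest (proj₁ (candidate⁺ x∈ x-full))))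
    ...   | false = cong (λ b → 𝟙 b + 0) (sym (dec-false (τ x ≟ᵛ T) τx≢T))
      where
      τx≢T : τ x ≢ T
      τx≢T τx≡T = contradiction (trans (sym T⊆τx) (trans (cong (T ⊆ᵇ_) τx≡T) (⊆ᵇ-refl T))) λ ()

    overlap-count : ∀ {x} → x ∈ V → 𝟙 (intersects T (τ x)) + 𝟙 (does (τ x ≟ᵛ ∁ T)) ≡ 1
    overlap-count {x} x∈ with intersects T (τ x) in T∩τx
    ... | true = cong (λ b → 1 + 𝟙 b) (dec-false (τ x ≟ᵛ ∁ T) τx≢∁T)
      where
      τx≢∁T : τ x ≢ ∁ T
      τx≢∁T τx≡∁T = contradiction
        (trans (sym T∩τx) (trans (cong (intersects T) τx≡∁T) (trans (intersects-∁ T T) (cong not (⊆ᵇ-refl T))))) λ ()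
    ... | false = cong 𝟙 (dec-true (τ x ≟ᵛ ∁ T) τx≡∁T)
      where
      T⊆∁τx : T ⊆ᵇ ∁ (τ x) ≡ true
      T⊆∁τx = trans (⊆ᵇ-∁ T (τ x)) (cong not T∩τx)
      x-partial : isFull x ≡ false
      x-partial with isFull x in x-full
      ... | true =
        contradiction (trans (sym (⊆ᵇ⇒intersects T (τ x) (full⊆ᵇ⇒⊆ᵇ T (τ x) x-full) T-nonempty)) T∩τx) λ ()
      ... | false = refl
      τx≡∁T : τ x ≡ ∁ T
      τx≡∁T = trans (sym (∁-involutive (τ x)))
        (cong ∁ (sym (⊆ᵇ-weight-antisym T (∁ (τ x)) T⊆∁τx (T-heaviest (proj₂ (candidate⁺ x∈ x-partial))))))

    copies-T≡copies-∁T : ConstantContribution V →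
      ∑ V (λ x → 𝟙 (does (τ x ≟ᵛ T))) ≡ ∑ V (λ x → 𝟙 (does (τ x ≟ᵛ ∁ T)))
    copies-T≡copies-∁T (c , constant) = +-cancelʳ-≡ f e d (+-cancelˡ-≡ a (e + f) (d + f) (begin
      a + (e + f)             ≡⟨ sym contribution-T ⟩
      ∑ V (contribution T)    ≡⟨ constant T T-nonempty ⟩
      c                       ≡⟨ sym (constant full full-nonempty) ⟩
      ∑ V (contribution full) ≡⟨ contribution-full ⟩
      length V + f            ≡⟨ cong (_+ f) (sym a+d≡length) ⟩
      (a + d) + f             ≡⟨ +-assoc a d f ⟩
      a + (d + f)             ∎))
      where
      open ≡-Reasoning
      f a e d : ℕ
      f = ∑ V (𝟙 ∘ isFull)
      a = ∑ V (λ x → 𝟙 (intersects T (τ x)))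
      e = ∑ V (λ x → 𝟙 (does (τ x ≟ᵛ T)))
      d = ∑ V (λ x → 𝟙 (does (τ x ≟ᵛ ∁ T)))
      full-nonempty : intersects {n} full full ≡ true
      full-nonempty = intersects⇒nonempty full (τ x₀) (occupied x₀∈)
      contribution-T : ∑ V (contribution T) ≡ a + (e + f)
      contribution-T = trans (∑-+ V _ _) (cong (a +_) (trans (∑-cong V included-count) (∑-+ V _ _)))
      contribution-full : ∑ V (contribution full) ≡ length V + f
      contribution-full = trans (∑-cong V (λ {x} x∈ → cong (λ b → 𝟙 b + 𝟙 (isFull x)) (occupied x∈)))
                                (trans (∑-+ V (λ _ → 1) _) (cong (_+ f) (∑-count-length V)))
      a+d≡length : a + d ≡ length V
      a+d≡length = trans (sym (∑-+ V _ _)) (trans (∑-cong V overlap-count) (∑-count-length V))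

    complementary-pair : ConstantContribution V → ∃₂ λ x y → x ∈ V × y ∈ V × τ y ≡ ∁ (τ x)
    complementary-pair constant =
      let x , x∈ , τx≟T = ∑𝟙-positive⇒∃ V copy-of-T (proj₁ copies)
          y , y∈ , τy≟∁T = ∑𝟙-positive⇒∃ V copy-of-∁T (proj₂ copies)
      in x , y , x∈ , y∈ , trans (does-true⇒ (τ y ≟ᵛ ∁ T) τy≟∁T) (cong ∁ (sym (does-true⇒ (τ x ≟ᵛ T) τx≟T)))
      where
      copy-of-T copy-of-∁T : ℕ → Bool
      copy-of-T x = does (τ x ≟ᵛ T)
      copy-of-∁T x = does (τ x ≟ᵛ ∁ T)
      copies≡ = copies-T≡copies-∁T constant
      copies : 1 ≤ ∑ V (𝟙 ∘ copy-of-T) × 1 ≤ ∑ V (𝟙 ∘ copy-of-∁T)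
      copies with T-candidate
      ... | x , x∈ , _ , inj₁ T≡τx =
        let e≥1 = ∃⇒∑𝟙-positive V copy-of-T x∈ (dec-true (τ x ≟ᵛ T) (sym T≡τx))
        in e≥1 , subst (1 ≤_) copies≡ e≥1
      ... | x , x∈ , _ , inj₂ T≡∁τx =
        let τx≡∁T = trans (sym (∁-involutive (τ x))) (cong ∁ (sym T≡∁τx))
            d≥1 = ∃⇒∑𝟙-positive V copy-of-∁T x∈ (dec-true (τ x ≟ᵛ ∁ T) τx≡∁T)
        in subst (1 ≤_) (sym copies≡) d≥1 , d≥1

  module _ {V x y V′} (V↭ : V ↭ x ∷ y ∷ V′) (τy≡∁τx : τ y ≡ ∁ (τ x)) where

    remove-pair-occupied : Occupied V → Occupied V′
    remove-pair-occupied occupied = occupied ∘ ∈-resp-↭ (↭-sym V↭) ∘ there ∘ there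

    remove-pair-constant : ConstantContribution V → ConstantContribution V′
    remove-pair-constant (c , constant) = c ∸ 2 , λ G G≠∅ → begin
      ∑ V′ (contribution G)
        ≡⟨ sym (m+n∸m≡n 2 _) ⟩
      2 + ∑ V′ (contribution G) ∸ 2
        ≡⟨ cong (λ k → k + ∑ V′ (contribution G) ∸ 2) (sym (pair≡2 G)) ⟩
      (contribution G x + contribution G y) + ∑ V′ (contribution G) ∸ 2
        ≡⟨ cong (_∸ 2) (+-assoc (contribution G x) (contribution G y) _) ⟩
      ∑ (x ∷ y ∷ V′) (contribution G) ∸ 2
        ≡⟨ cong (_∸ 2) (sym (∑-↭ _ V↭)) ⟩
      ∑ V (contribution G) ∸ 2
        ≡⟨ cong (_∸ 2) (constant G G≠∅) ⟩
      c ∸ 2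
        ∎
      where
      open ≡-Reasoning
      pair≡2 : ∀ G → contribution G x + contribution G y ≡ 2
      pair≡2 G = trans (cong (λ t → contribution G x + (𝟙 (intersects G t) + 𝟙 (G ⊆ᵇ t))) τy≡∁τx)
                       (contribution-complementary G (τ x))

    extend : Splitting V′ → Splitting V
    extend (P , K , K++points↭V′ , K-full , P-complementary) =
      (x , y) ∷ P , K , K++points↭V , K-full , λ { (here refl) → τy≡∁τx ; (there p∈) → P-complementary p∈ }
      where
      K++points↭V : K ++ x ∷ y ∷ points P ↭ V
      K++points↭V = ↭-trans (shift x K (y ∷ points P))
        (↭-trans (↭-prep x (↭-trans (shift y K (points P)) (↭-prep y K++points↭V′))) (↭-sym V↭))

  decompose : ∀ m V → length V ≤ m → Occupied V → ConstantContribution V → Splitting V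
  decompose zero [] _ _ _ = [] , [] , ↭-refl , (λ ()) , λ ()
  decompose (suc m) V |V|≤1+m occupied constant with all? (λ x → isFull x ≟ᵇ true) V
  ... | yes all-full = [] , V , ↭-reflexive (++-identityʳ V) , All.lookup all-full , λ ()
  ... | no ¬all-full
    with x₀ , x₀∈ , x₀-not-full ← find (¬All⇒Any¬ (λ x → isFull x ≟ᵇ true) V ¬all-full)
    with x , y , x∈ , y∈ , τy≡∁τx ← HeaviestCandidate.complementary-pair occupied x₀∈ (¬-not x₀-not-full) constant
    with V′ , V↭ ← ↭-extract₂ x∈ y∈ (nonempty⇒≢∁ (τ x) (occupied x∈) ∘ λ x≡y →
                                      trans (cong τ x≡y) τy≡∁τx)
    = extend V↭ τy≡∁τx (decompose m V′ |V′|≤m (remove-pair-occupied V↭ τy≡∁τx occupied)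
                                             (remove-pair-constant V↭ τy≡∁τx constant))
    where
    |V′|≤m : length V′ ≤ m
    |V′|≤m = ≤-pred (≤-trans (n≤1+n _) (subst (_≤ suc m) (↭-length V↭) |V|≤1+m))

-- An hke collection consists of transversals

typeIn : (F : Collection) → ℕ → Vec Bool (length F)
typeIn [] x = []
typeIn (S ∷ F) x = x ∈ᵇ S ∷ typeIn F x

select : (F : Collection) → Vec Bool (length F) → Collection
select [] [] = []
select (S ∷ F) (true ∷ G) = S ∷ select F G
select (S ∷ F) (false ∷ G) = select F G

select-full : ∀ F → select F full ≡ F
select-full [] = refl
select-full (S ∷ F) = cong (S ∷_) (select-full F)

select⊆ : ∀ F G {S} → S ∈ select F G → S ∈ F
select⊆ [] [] ()
select⊆ (S ∷ F) (true ∷ G) (here refl) = here refl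
select⊆ (S ∷ F) (true ∷ G) (there S∈) = there (select⊆ F G S∈)
select⊆ (S ∷ F) (false ∷ G) S∈ = there (select⊆ F G S∈)

select-nonempty : ∀ F G → intersects G full ≡ true → select F G ≢ []
select-nonempty [] [] ()
select-nonempty (S ∷ F) (true ∷ G) _ ()
select-nonempty (S ∷ F) (false ∷ G) G≠∅ = select-nonempty F G G≠∅

intersects-typeIn : ∀ F G x → intersects G (typeIn F x) ≡ does (any? (x ∈?_) (select F G))
intersects-typeIn [] [] x = refl
intersects-typeIn (S ∷ F) (true ∷ G) x = cong (x ∈ᵇ S ∨_) (intersects-typeIn F G x)
intersects-typeIn (S ∷ F) (false ∷ G) x = intersects-typeIn F G x

⊆ᵇ-typeIn : ∀ F G x → G ⊆ᵇ typeIn F x ≡ does (all? (x ∈?_) (select F G))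
⊆ᵇ-typeIn [] [] x = refl
⊆ᵇ-typeIn (S ∷ F) (true ∷ G) x = cong (x ∈ᵇ S ∧_) (⊆ᵇ-typeIn F G x)
⊆ᵇ-typeIn (S ∷ F) (false ∷ G) x = ⊆ᵇ-typeIn F G x

intersects-typeIn-⋃ : ∀ F G x → intersects G (typeIn F x) ≡ x ∈ᵇ ⋃ (select F G)
intersects-typeIn-⋃ F G x = trans (intersects-typeIn F G x)
  (does-cong (any? (x ∈?_) Γ) (x ∈? ⋃ Γ) (λ x∈some → let S , S∈ , x∈S = find x∈some in ∈-⋃⁺ S∈ x∈S)
                                          (λ x∈ → let S , S∈ , x∈S = ∈-⋃⁻ Γ x∈ in lose S∈ x∈S))
  where Γ = select F G

⊆ᵇ-typeIn-⋂ : ∀ F G x → intersects G full ≡ true → G ⊆ᵇ typeIn F x ≡ x ∈ᵇ ⋂ (select F G)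
⊆ᵇ-typeIn-⋂ F G x G≠∅ = trans (⊆ᵇ-typeIn F G x)
  (does-cong (all? (x ∈?_) Γ) (x ∈? ⋂ Γ) (∈-⋂⁺ Γ (select-nonempty F G G≠∅) ∘ All.lookup)
                                          (λ x∈ → All.tabulate (∈-⋂⁻ Γ x∈)))
  where Γ = select F G

typeIn-occupied : ∀ F {x} → x ∈ ⋃ F → intersects full (typeIn F x) ≡ true
typeIn-occupied F {x} x∈ = trans (intersects-typeIn-⋃ F full x)
  (trans (cong (λ Γ → x ∈ᵇ ⋃ Γ) (select-full F)) (dec-true (x ∈? ⋃ F) x∈))

typeIn-full : ∀ F {x} → full ⊆ᵇ typeIn F x ≡ true → ∀ {S} → S ∈ F → x ∈ S
typeIn-full F {x} x-full = All.lookup (subst (All (x ∈_)) (select-full F)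
  (does-true⇒ (all? (x ∈?_) (select F full)) (trans (sym (⊆ᵇ-typeIn F full x)) x-full)))

typeIn-∁ : ∀ F {x y} → typeIn F y ≡ ∁ (typeIn F x) → ∀ {S} → S ∈ F → (x ∈ S) ⇔ (y ∉ S)
typeIn-∁ (S ∷ F) {x} {y} τy≡∁τx (here refl) = 𝟙-exactlyOne (x ∈? S) (y ∈? S)
  (trans (cong (λ b → 𝟙 (x ∈ᵇ S) + 𝟙 b) (cong Vec.head τy≡∁τx)) (𝟙-not (x ∈ᵇ S)))
typeIn-∁ (S ∷ F) τy≡∁τx (there S∈) = typeIn-∁ F (cong Vec.tail τy≡∁τx) S∈

module _ (F : Collection) where
  open Decomposition (typeIn F)

  ⋃-occupied : Occupied (deduplicate _≟_ (⋃ F))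
  ⋃-occupied = typeIn-occupied F ∘ ∈-deduplicate⁻ _≟_ (⋃ F)

  HKE⇒constant-contribution : HKE F → ConstantContribution (deduplicate _≟_ (⋃ F))
  HKE⇒constant-contribution (α , _ , hke) = 2 * α , λ G G≠∅ → let Γ = select F G in begin
    ∑ U (contribution G)
      ≡⟨ ∑-cong U (λ {x} _ → cong₂ _+_ (cong 𝟙 (intersects-typeIn-⋃ F G x))
                                       (cong 𝟙 (⊆ᵇ-typeIn-⋂ F G x G≠∅))) ⟩
    ∑ U (λ x → 𝟙 (x ∈ᵇ ⋃ Γ) + 𝟙 (x ∈ᵇ ⋂ Γ))
      ≡⟨ ∑-+ U _ _ ⟩
    ∑ U (λ x → 𝟙 (x ∈ᵇ ⋃ Γ)) + ∑ U (λ x → 𝟙 (x ∈ᵇ ⋂ Γ))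
      ≡⟨ sym (cong₂ _+_ (card≡∑ (⋃ Γ) (deduplicate-! (⋃ F)) (⋃select⊆U G))
                        (card≡∑ (⋂ Γ) (deduplicate-! (⋃ F)) (⋃select⊆U G ∘ ⋂⊆⋃ Γ))) ⟩
    card (⋃ Γ) + card (⋂ Γ)
      ≡⟨ hke Γ (select-nonempty F G G≠∅ , All.tabulate (select⊆ F G)) ⟩
    2 * α
      ∎
    where
    open ≡-Reasoning
    U = deduplicate _≟_ (⋃ F)
    ⋃select⊆U : ∀ G → ⋃ (select F G) ⊆ U
    ⋃select⊆U G x∈ =
      let S , S∈ , x∈S = ∈-⋃⁻ (select F G) x∈ in ∈-deduplicate⁺ _≟_ (∈-⋃⁺ (select⊆ F G S∈) x∈S)

-- x + M is a new point when M exceeds every element in use.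
pad : ℕ → List ℕ → Pairing
pad M = map (λ x → x , x + M)

∈points-pad⁻ : ∀ M K {y} → y ∈ points (pad M K) → y ∈ K ⊎ ∃ λ z → z ∈ K × y ≡ z + M
∈points-pad⁻ M K y∈ with ∈points⁻ (pad M K) y∈
... | p , p∈ , y≡ with ∈-map⁻ (λ x → x , x + M) p∈
...   | z , z∈K , refl with y≡
...     | inj₁ refl = inj₁ z∈K
...     | inj₂ refl = inj₂ (z , z∈K , refl)

pad-disjoint : ∀ M {K} → Unique K → (∀ {x} → x ∈ K → x < M) → DisjointPairs (pad M K)
pad-disjoint M {[]} _ _ = []
pad-disjoint M {x ∷ K} (x∉K ∷ uK) <M = unique-∷ x∉ (unique-∷ x+M∉ (pad-disjoint M uK (<M ∘ there)))
  where
  x∉ : x ∉ x + M ∷ points (pad M K)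
  x∉ (here x≡x+M) = <⇒≱ (<M (here refl)) (subst (M ≤_) (sym x≡x+M) (m≤n+m M x))
  x∉ (there x∈) with ∈points-pad⁻ M K x∈
  ... | inj₁ x∈K = All.lookup x∉K x∈K refl
  ... | inj₂ (z , z∈K , x≡z+M) = <⇒≱ (<M (here refl)) (subst (M ≤_) (sym x≡z+M) (m≤n+m M z))
  x+M∉ : x + M ∉ points (pad M K)
  x+M∉ x+M∈ with ∈points-pad⁻ M K x+M∈
  ... | inj₁ x+M∈K = <⇒≱ (<M (there x+M∈K)) (m≤n+m M x)
  ... | inj₂ (z , z∈K , x+M≡z+M) = All.lookup x∉K (subst (_∈ K) (sym (+-cancelʳ-≡ M x z x+M≡z+M)) z∈K) refl

module _ {F : Collection} where
  open Decomposition (typeIn F)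

  -- The full elements K lie in every member of F, so pairing them with new points keeps every
  -- member a transversal.
  splitting⇒transversals : ∀ {P K} → K ++ points P ↭ deduplicate _≟_ (⋃ F) → (∀ {x} → x ∈ K → isFull x ≡ true) →
    (∀ {p} → p ∈ P → typeIn F (proj₂ p) ≡ ∁ (typeIn F (proj₁ p))) →
    Σ Pairing λ Q → DisjointPairs Q × (∀ {S} → S ∈ F → Transversal Q S)
  splitting⇒transversals {P} {K} K++P↭U K-full P-complementary = P ++ pad M K , disjoint , transversal
    where
    M = suc (sum (⋃ F))
    <M : ∀ {x} → x ∈ ⋃ F → x < M
    <M x∈ = s≤s (∈⇒≤sum x∈)
    ∈⋃F : ∀ {x} → x ∈ K ++ points P → x ∈ ⋃ F
    ∈⋃F = ∈-deduplicate⁻ _≟_ (⋃ F) ∘ ∈-resp-↭ K++P↭U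
    unique-K++P = Unique-++⁻ K (Unique-resp-↭′ (↭-sym K++P↭U) (deduplicate-! (⋃ F)))
    K#P = proj₂ (proj₂ unique-K++P)
    P#pad : Disjoint (points P) (points (pad M K))
    P#pad (y∈P , y∈pad) with ∈points-pad⁻ M K y∈pad
    ... | inj₁ y∈K = K#P (y∈K , y∈P)
    ... | inj₂ (z , z∈K , refl) = <⇒≱ (<M (∈⋃F (∈-++⁺ʳ K y∈P))) (m≤n+m M z)
    disjoint : DisjointPairs (P ++ pad M K)
    disjoint = subst Unique (sym (points-++ P (pad M K)))
      (++⁺ (proj₁ (proj₂ unique-K++P)) (pad-disjoint M (proj₁ unique-K++P) (<M ∘ ∈⋃F ∘ ∈-++⁺ˡ)) P#pad)
    transversal : ∀ {S} → S ∈ F → Transversal (P ++ pad M K) S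
    transversal {S} S∈ = ⊆points , exactlyOne
      where
      ⊆points : S ⊆ points (P ++ pad M K)
      ⊆points x∈S with ∈-++⁻ K (∈-resp-↭ (↭-sym K++P↭U) (∈-deduplicate⁺ _≟_ (∈-⋃⁺ S∈ x∈S)))
      ... | inj₁ x∈K = subst (_ ∈_) (sym (points-++ P (pad M K)))
                         (∈-++⁺ʳ (points P) (fst∈points (∈-map⁺ (λ x → x , x + M) x∈K)))
      ... | inj₂ x∈P = subst (_ ∈_) (sym (points-++ P (pad M K))) (∈-++⁺ˡ x∈P)
      exactlyOne : ∀ {p} → p ∈ P ++ pad M K → (proj₁ p ∈ S) ⇔ (proj₂ p ∉ S)
      exactlyOne p∈ with ∈-++⁻ P p∈
      ... | inj₁ p∈P = typeIn-∁ F (P-complementary p∈P) S∈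
      ... | inj₂ p∈pad with ∈-map⁻ (λ x → x , x + M) p∈pad
      ...   | z , z∈K , refl = mk⇔ (λ _ z+M∈S → <⇒≱ (<M (∈-⋃⁺ S∈ z+M∈S)) (m≤n+m M z))
                                   (λ _ → typeIn-full F (K-full z∈K) S∈)

HKE⇒transversals : ∀ {α F} → Relevant α F → HKE F →
  Σ Pairing λ Q → DisjointPairs Q × length Q ≡ α × (∀ {S} → S ∈ F → Transversal Q S)
HKE⇒transversals {α} {S₀ ∷ F} (_ , _ , card≡α) hke
  with P , K , K++P↭U , K-full , P-complementary ←
         Decomposition.decompose (typeIn (S₀ ∷ F)) _ _ ≤-refl
           (⋃-occupied (S₀ ∷ F)) (HKE⇒constant-contribution (S₀ ∷ F) hke)
  with Q , disjoint , transversal ← splitting⇒transversals K++P↭U K-full P-complementary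
  = Q , disjoint , trans (sym (card-transversal disjoint (transversal (here refl)))) (All.lookup card≡α (here refl)) , transversal
HKE⇒transversals {F = []} (F≢[] , _) _ = contradiction refl F≢[]

-- The typical collection

pairsFrom : ℕ → ℕ → ℕ → Pairing
pairsFrom α k zero = []
pairsFrom α k (suc m) = (k , k + α) ∷ pairsFrom α (suc k) m

length-pairsFrom : ∀ α k m → length (pairsFrom α k m) ≡ m
length-pairsFrom α k zero = refl
length-pairsFrom α k (suc m) = cong suc (length-pairsFrom α (suc k) m)

∈pairsFrom⁻ : ∀ α k m {p} → p ∈ pairsFrom α k m → ∃ λ i → k ≤ i × i < k + m × p ≡ (i , i + α)
∈pairsFrom⁻ α k (suc m) (here refl) = k , ≤-refl , m<m+n k z<s , refl
∈pairsFrom⁻ α k (suc m) (there p∈) =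
  let i , k<i , i< , p≡ = ∈pairsFrom⁻ α (suc k) m p∈
  in i , ≤-trans (n≤1+n k) k<i , subst (i <_) (sym (+-suc k m)) i< , p≡

∈pairsFrom⁺ : ∀ α k m {i} → k ≤ i → i < k + m → (i , i + α) ∈ pairsFrom α k m
∈pairsFrom⁺ α k zero k≤i i< = contradiction (subst (_ <_) (+-identityʳ k) i<) (≤⇒≯ k≤i)
∈pairsFrom⁺ α k (suc m) {i} k≤i i< with k ≟ i
... | yes refl = here refl
... | no k≢i = there (∈pairsFrom⁺ α (suc k) m (≤∧≢⇒< k≤i k≢i) (subst (i <_) (+-suc k m) i<))

∈points-pairsFrom⁻ : ∀ α k m {y} → y ∈ points (pairsFrom α k m) →
  ∃ λ i → k ≤ i × i < k + m × (y ≡ i ⊎ y ≡ i + α)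
∈points-pairsFrom⁻ α k m y∈ with ∈points⁻ (pairsFrom α k m) y∈
... | p , p∈ , y≡ with ∈pairsFrom⁻ α k m p∈
...   | i , k≤i , i< , refl = i , k≤i , i< , y≡

pairsFrom-disjoint : ∀ α k m → 1 ≤ k → k + m ≤ suc α → DisjointPairs (pairsFrom α k m)
pairsFrom-disjoint α k zero _ _ = []
pairsFrom-disjoint α k (suc m) 1≤k bound =
  unique-∷ k∉ (unique-∷ k+α∉ (pairsFrom-disjoint α (suc k) m (≤-trans 1≤k (n≤1+n k)) bound′))
  where
  bound′ : suc k + m ≤ suc α
  bound′ = subst (_≤ suc α) (+-suc k m) bound
  k+m≤α : k + m ≤ α
  k+m≤α = ≤-pred bound′
  k∉ : k ∉ k + α ∷ points (pairsFrom α (suc k) m)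
  k∉ (here k≡k+α) = <⇒≢ (m<m+n k (≤-trans 1≤k (≤-trans (m≤m+n k m) k+m≤α))) k≡k+α
  k∉ (there k∈) with ∈points-pairsFrom⁻ α (suc k) m k∈
  ... | i , k<i , _ , inj₁ k≡i = <⇒≢ k<i k≡i
  ... | i , k<i , _ , inj₂ k≡i+α = <⇒≢ (≤-trans k<i (m≤m+n i α)) k≡i+α
  k+α∉ : k + α ∉ points (pairsFrom α (suc k) m)
  k+α∉ k+α∈ with ∈points-pairsFrom⁻ α (suc k) m k+α∈
  ... | i , _ , i< , inj₁ k+α≡i = <⇒≢ (≤-<-trans (≤-trans (≤-pred i<) k+m≤α) (m<n+m α 1≤k)) (sym k+α≡i)
  ... | i , k<i , _ , inj₂ k+α≡i+α = <⇒≢ k<i (+-cancelʳ-≡ α k i k+α≡i+α)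

typicalPairing : ℕ → Pairing
typicalPairing α = pairsFrom α 1 α

typicalPairing-disjoint : ∀ α → DisjointPairs (typicalPairing α)
typicalPairing-disjoint α = pairsFrom-disjoint α 1 α ≤-refl ≤-refl

∈typicalPairing⁻ : ∀ α {p} → p ∈ typicalPairing α → ∃ λ i → 1 ≤ i × i ≤ α × p ≡ (i , i + α)
∈typicalPairing⁻ α p∈ = let i , 1≤i , i< , p≡ = ∈pairsFrom⁻ α 1 α p∈ in i , 1≤i , ≤-pred i< , p≡

∈typicalPairing⁺ : ∀ α {i} → 1 ≤ i → i ≤ α → (i , i + α) ∈ typicalPairing α
∈typicalPairing⁺ α 1≤i i≤α = ∈pairsFrom⁺ α 1 α 1≤i (s≤s i≤α)

Typical⇒Transversal : ∀ α {S} → Typical α S → Transversal (typicalPairing α) S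
Typical⇒Transversal α {S} (range , exactlyOne) = ⊆points , pairs
  where
  ⊆points : S ⊆ points (typicalPairing α)
  ⊆points {x} x∈ with All.lookup range x∈ | x ≤? α
  ... | 1≤x , _ | yes x≤α = fst∈points (∈typicalPairing⁺ α 1≤x x≤α)
  ... | _ , x≤2α | no x≰α =
    subst (_∈ points (typicalPairing α)) (m∸n+n≡m (<⇒≤ α<x))
      (snd∈points (∈typicalPairing⁺ α (m<n⇒0<n∸m α<x)
        (subst (x ∸ α ≤_) (+-identityʳ α) (m≤n+o⇒m∸n≤o x α x≤2α))))
    where
    α<x : α < x
    α<x = ≰⇒> x≰α
  pairs : ∀ {p} → p ∈ typicalPairing α → (proj₁ p ∈ S) ⇔ (proj₂ p ∉ S)
  pairs p∈ with ∈typicalPairing⁻ α p∈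
  ... | i , 1≤i , i≤α , refl = exactlyOne i 1≤i i≤α

Transversal⇒Typical : ∀ α {S} → Transversal (typicalPairing α) S → Typical α S
Transversal⇒Typical α {S} (⊆points , pairs) = All.tabulate range , λ i 1≤i i≤α → pairs (∈typicalPairing⁺ α 1≤i i≤α)
  where
  range : ∀ {x} → x ∈ S → 1 ≤ x × x ≤ 2 * α
  range x∈ with ∈points⁻ (typicalPairing α) (⊆points x∈)
  ... | p , p∈ , x≡ with ∈typicalPairing⁻ α p∈
  ...   | i , 1≤i , i≤α , refl with x≡
  ...     | inj₁ refl = 1≤i , ≤-trans i≤α (m≤m+n α _)
  ...     | inj₂ refl =
    ≤-trans 1≤i (m≤m+n i α) , subst (i + α ≤_) (cong (α +_) (sym (+-identityʳ α))) (+-monoˡ-≤ α i≤α)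

⋃Typical⇒points : ∀ α {y} → ⋃P (Typical α) y → y ∈ points (typicalPairing α)
⋃Typical⇒points α (S , typical , y∈) = proj₁ (Typical⇒Transversal α typical) y∈

points⇒⋃Typical : ∀ α {y} → y ∈ points (typicalPairing α) → ⋃P (Typical α) y
points⇒⋃Typical α y∈ =
  let C , trC , y∈C = transversal-cover (typicalPairing-disjoint α) y∈ in C , Transversal⇒Typical α trC , y∈C

-- Relabelling pairings

mapPair : (ℕ → ℕ) → ℕ × ℕ → ℕ × ℕ
mapPair h p = h (proj₁ p) , h (proj₂ p)

points-map : ∀ h P → points (map (mapPair h) P) ≡ map h (points P)
points-map h [] = refl
points-map h ((a , b) ∷ P) = cong (λ l → h a ∷ h b ∷ l) (points-map h P)

points-injective : ∀ P R → points P ≡ points R → P ≡ R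
points-injective [] [] _ = refl
points-injective ((a , b) ∷ P) ((c , d) ∷ R) eq
  with refl , eq′ ← ∷-injective eq
  with refl , eq″ ← ∷-injective eq′ = cong ((a , b) ∷_) (points-injective P R eq″)

module Relabelling {P : Pairing} {g h : ℕ → ℕ} (g∘h≗id : ∀ {y} → y ∈ points P → g (h y) ≡ y) where

  h∘g≗id : ∀ {x} → x ∈ points (map (mapPair h) P) → h (g x) ≡ x
  h∘g≗id x∈ with ∈-map⁻ h (subst (_ ∈_) (points-map h P) x∈)
  ... | y , y∈ , refl = cong h (g∘h≗id y∈)

  g∈points : ∀ {x} → x ∈ points (map (mapPair h) P) → g x ∈ points P
  g∈points x∈ with ∈-map⁻ h (subst (_ ∈_) (points-map h P) x∈)
  ... | y , y∈ , refl = subst (_∈ points P) (sym (g∘h≗id y∈)) y∈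

  h∈points : ∀ {y} → y ∈ points P → h y ∈ points (map (mapPair h) P)
  h∈points y∈ = subst (_ ∈_) (sym (points-map h P)) (∈-map⁺ h y∈)

  relabelled-disjoint : DisjointPairs P → DisjointPairs (map (mapPair h) P)
  relabelled-disjoint disj = subst Unique (sym (points-map h P)) (Unique-map-injectiveOn h-injective disj)
    where
    h-injective : ∀ {x y} → x ∈ points P → y ∈ points P → h x ≡ h y → x ≡ y
    h-injective x∈ y∈ hx≡hy = trans (sym (g∘h≗id x∈)) (trans (cong g hx≡hy) (g∘h≗id y∈))

  transversal⁺ : ∀ {S} → Transversal P S → Transversal (map (mapPair h) P) (map h S)
  transversal⁺ {S} (⊆points , pairs) = ⊆points′ , pairs′
    where
    h∈⇔∈ : ∀ {a} → a ∈ points P → (h a ∈ map h S) ⇔ (a ∈ S)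
    h∈⇔∈ {a} a∈ = mk⇔
      (λ ha∈ → let y , y∈S , ha≡hy = ∈-map⁻ h ha∈ in
               subst (_∈ S) (trans (sym (g∘h≗id (⊆points y∈S))) (trans (cong g (sym ha≡hy)) (g∘h≗id a∈))) y∈S)
      (∈-map⁺ h)
    ⊆points′ : map h S ⊆ points (map (mapPair h) P)
    ⊆points′ x∈ with ∈-map⁻ h x∈
    ... | y , y∈S , refl = h∈points (⊆points y∈S)
    pairs′ : ∀ {q} → q ∈ map (mapPair h) P → (proj₁ q ∈ map h S) ⇔ (proj₂ q ∉ map h S)
    pairs′ q∈ with ∈-map⁻ (mapPair h) q∈
    ... | p , p∈ , refl = ⇔¬-cong (h∈⇔∈ (fst∈points p∈)) (h∈⇔∈ (snd∈points p∈)) (pairs p∈)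

  transversal⁻ : ∀ {S} → Transversal (map (mapPair h) P) S → Transversal P (map g S)
  transversal⁻ {S} (⊆points , pairs) = ⊆points′ , pairs′
    where
    ∈g⇔h∈ : ∀ {a} → a ∈ points P → (a ∈ map g S) ⇔ (h a ∈ S)
    ∈g⇔h∈ {a} a∈ = mk⇔
      (λ a∈gS → let s , s∈S , a≡gs = ∈-map⁻ g a∈gS in
                subst (_∈ S) (sym (trans (cong h a≡gs) (h∘g≗id (⊆points s∈S)))) s∈S)
      (λ ha∈S → subst (_∈ map g S) (g∘h≗id a∈) (∈-map⁺ g ha∈S))
    ⊆points′ : map g S ⊆ points P
    ⊆points′ x∈ with ∈-map⁻ g x∈
    ... | s , s∈S , refl = g∈points (⊆points s∈S)
    pairs′ : ∀ {p} → p ∈ P → (proj₁ p ∈ map g S) ⇔ (proj₂ p ∉ map g S)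
    pairs′ p∈ = ⇔¬-cong (∈g⇔h∈ (fst∈points p∈)) (∈g⇔h∈ (snd∈points p∈)) (pairs (∈-map⁺ (mapPair h) p∈))

relabel : List ℕ → List ℕ → ℕ → ℕ
relabel (a ∷ A) (b ∷ B) x with x ≟ a
... | yes _ = b
... | no _ = relabel A B x
relabel _ _ x = x

relabel-∈ : ∀ A B {x} → length A ≡ length B → x ∈ A → relabel A B x ∈ B
relabel-∈ (a ∷ A) (b ∷ B) {x} |A|≡|B| x∈ with x ≟ a
... | yes _ = here refl
... | no x≢a with x∈
...   | here x≡a = contradiction x≡a x≢a
...   | there x∈A = there (relabel-∈ A B (suc-injective |A|≡|B|) x∈A)

relabel-inverse : ∀ A B {x} → Unique A → Unique B → length A ≡ length B → x ∈ A → relabel B A (relabel A B x) ≡ x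
relabel-inverse (a ∷ A) (b ∷ B) {x} _ _ _ x∈ with x ≟ a
relabel-inverse (a ∷ A) (b ∷ B) _ _ _ _ | yes refl with b ≟ b
... | yes _ = refl
... | no b≢b = contradiction refl b≢b
relabel-inverse (a ∷ A) (b ∷ B) _ _ _ (here x≡a) | no x≢a = contradiction x≡a x≢a
relabel-inverse (a ∷ A) (b ∷ B) {x} (_ ∷ uA) (b∉ ∷ uB) |A|≡|B| (there x∈A) | no _ with relabel A B x ≟ b
... | yes ≡b = contradiction (sym ≡b) (All.lookup b∉ (relabel-∈ A B (suc-injective |A|≡|B|) x∈A))
... | no _ = relabel-inverse A B uA uB (suc-injective |A|≡|B|) x∈A

map-relabel : ∀ A B → Unique A → length A ≡ length B → map (relabel A B) A ≡ B
map-relabel [] [] _ _ = refl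
map-relabel (a ∷ A) (b ∷ B) (a∉ ∷ u) |A|≡|B| with a ≟ a
... | no a≢a = contradiction refl a≢a
... | yes _ = cong (b ∷_) (trans (map-cong-local (All.tabulate agrees)) (map-relabel A B u (suc-injective |A|≡|B|)))
  where
  agrees : ∀ {x} → x ∈ A → relabel (a ∷ A) (b ∷ B) x ≡ relabel A B x
  agrees {x} x∈ with x ≟ a
  ... | yes refl = contradiction refl (All.lookup a∉ x∈)
  ... | no _ = refl

pairings-relabel : ∀ {P Q} → DisjointPairs P → DisjointPairs Q → length P ≡ length Q →
  Σ (ℕ → ℕ) λ g → Σ (ℕ → ℕ) λ h → (∀ {y} → y ∈ points P → g (h y) ≡ y) × map (mapPair h) P ≡ Q
pairings-relabel {P} {Q} disjP disjQ |P|≡|Q| =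
  relabel (points Q) (points P) , h , relabel-inverse (points P) (points Q) disjP disjQ |points|≡ ,
  points-injective _ Q (trans (points-map h P) (map-relabel (points P) (points Q) disjP |points|≡))
  where
  h = relabel (points P) (points Q)
  |points|≡ : length (points P) ≡ length (points Q)
  |points|≡ = trans (length-points P) (trans (cong (2 *_) |P|≡|Q|) (sym (length-points Q)))

TransversalStructure : ℕ → Collection → Set
TransversalStructure α F = Σ Pairing λ Q → DisjointPairs Q × length Q ≡ α × AllTransversals Q F

⋃⇔points : ∀ {Q F} → DisjointPairs Q → AllTransversals Q F → ∀ {x} → (x ∈ ⋃ F) ⇔ (x ∈ points Q)
⋃⇔points {Q} {F} disj (trF , containsF) {x} = mk⇔
  (λ x∈ → let S , S∈ , x∈S = ∈-⋃⁻ F x∈ in proj₁ (trF S∈) x∈S)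
  (λ x∈ → let C , trC , x∈C = transversal-cover disj x∈
              T , T∈ , C≈T = containsF trC
          in ∈-⋃⁺ T∈ (to (C≈T x) x∈C))

MaximalHKE⇔TransversalStructure : ∀ {α F} → Relevant α F → MaximalHKE F ⇔ TransversalStructure α F
MaximalHKE⇔TransversalStructure {α} {F} relevant@(_ , 0<α , _) = mk⇔ maximal⇒structure structure⇒maximal
  where
  maximal⇒structure : MaximalHKE F → TransversalStructure α F
  maximal⇒structure maximal with Q , disj , |Q|≡α , trF ← HKE⇒transversals relevant (proj₁ maximal) =
    Q , disj , |Q|≡α , trF , MaximalHKE⇒contains-transversals maximal disj (subst (0 <_) (sym |Q|≡α) 0<α) trF
  structure⇒maximal : TransversalStructure α F → MaximalHKE F
  structure⇒maximal (Q , disj , |Q|≡α , all) = AllTransversals⇒MaximalHKE disj (subst (0 <_) (sym |Q|≡α) 0<α) all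

TransversalStructure⇒Isomorphic : ∀ {α F} → TransversalStructure α F → Isomorphic F (Typical α)
TransversalStructure⇒Isomorphic {α} {F} (Q , disj , |Q|≡α , all)
  with g , h , g∘h≗id , refl ←
         pairings-relabel (typicalPairing-disjoint α) disj (trans (length-pairsFrom α 1 α) (sym |Q|≡α))
  = g , h
  , (λ x x∈ → points⇒⋃Typical α (g∈points (to ⋃F⇔points x∈)))
  , (λ y y∈ → from ⋃F⇔points (h∈points (⋃Typical⇒points α y∈)))
  , (λ x x∈ → h∘g≗id (to ⋃F⇔points x∈))
  , (λ y y∈ → g∘h≗id (⋃Typical⇒points α y∈))
  , (λ S S∈ → Transversal⇒Typical α (transversal⁻ (proj₁ all S∈)))
  , (λ S typical → proj₂ all (transversal⁺ (Typical⇒Transversal α typical)))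
  where
  open Relabelling {typicalPairing α} {g} {h} g∘h≗id
  ⋃F⇔points : ∀ {x} → (x ∈ ⋃ F) ⇔ (x ∈ points (map (mapPair h) (typicalPairing α)))
  ⋃F⇔points = ⋃⇔points disj all

Isomorphic⇒TransversalStructure : ∀ {α F} → Isomorphic F (Typical α) → TransversalStructure α F
Isomorphic⇒TransversalStructure {α} {F} (g , h , _ , _ , h∘g≗id-on-⋃F , g∘h≗id-on-⋃Typical , typical-g , contains-h) =
  map (mapPair h) P , relabelled-disjoint (typicalPairing-disjoint α) ,
  trans (length-map (mapPair h) P) (length-pairsFrom α 1 α) , transversal , contained
  where
  P = typicalPairing α
  open Relabelling {P} {g} {h} (λ y∈ → g∘h≗id-on-⋃Typical _ (points⇒⋃Typical α y∈))
  transversal : ∀ {S} → S ∈ F → Transversal (map (mapPair h) P) S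
  transversal {S} S∈ = Transversal-resp-SetEq (map-inverse-SetEq (λ {x} x∈ → h∘g≗id-on-⋃F x (∈-⋃⁺ S∈ x∈)))
    (transversal⁺ (Typical⇒Transversal α (typical-g S S∈)))
  contained : ∀ {C} → Transversal (map (mapPair h) P) C → C ∈c F
  contained {C} trC =
    let T , T∈ , hgC≈T = contains-h (map g C) (Transversal⇒Typical α (transversal⁻ trC))
    in T , T∈ , SetEq-trans (map-inverse-SetEq (h∘g≗id ∘ proj₁ trC)) hgC≈T

Isomorphic⇔TransversalStructure : ∀ {α F} → Isomorphic F (Typical α) ⇔ TransversalStructure α F
Isomorphic⇔TransversalStructure = mk⇔ Isomorphic⇒TransversalStructure TransversalStructure⇒Isomorphic

mainTheorem3 : (α : ℕ) (F : Collection) → Relevant α F →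
    MaximalHKE F ⇔ Isomorphic F (Typical α)
mainTheorem3 α F relevant =
  ⇔-trans (MaximalHKE⇔TransversalStructure relevant) (⇔-sym Isomorphic⇔TransversalStructure)
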